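{- The cut rule is admissible in $\mathbf{G}(\mathsf{FBInqBQ})$: for all finite multisets $\Gamma,\Delta,\Pi,\Sigma$ of labelled formulas and every labelled formula $X:\varphi$, if $\Gamma\Rightarrow\Delta,X:\varphi$ and $X:\varphi,\Pi\Rightarrow\Sigma$ are both derivable in $\mathbf{G}(\mathsf{FBInqBQ})$, then $\Gamma,\Pi\Rightarrow\Delta,\Sigma$ is derivable in $\mathbf{G}(\mathsf{FBInqBQ})$.
   Context: Language: countably infinite set of variables, countably infinite set of predicate symbols with arities (no identity, constants, function symbols). Formulas: $\varphi ::= P(x_1,\dots,x_m)\mid \bot\mid \varphi\to\varphi\mid\varphi\wedge\varphi\mid \varphi\veebar\varphi\mid \forall x\varphi\mid \bar\exists x\varphi$ ($\veebar$ inquisitive disjunction, $\bar\exists$ inquisitive existential). $\varphi[z/x]$ is capture-avoiding substitution. Calculus $\mathbf{G}(\mathsf{FBInqBQ})$: a label is a nonempty finite subset of $\omega$; a labelled formula is $X:\varphi$ with $X$ a label; a sequent $\Gamma\Rightarrow\Delta$ is a pair of finite multisets of labelled formulas. $X,Y$ range over labels. Initial sequents: $(\mathtt{id})$ $X:P(\bar x),\Gamma\Rightarrow\Delta,Y:P(\bar x)$ whenever $X\supseteq Y$; $(\bot\Rightarrow)$ $X:\bot,\Gamma\Rightarrow\Delta$. Rules (premises / conclusion): $(\Rightarrow\mathtt{at})$: $\Gamma\Rightarrow\Delta,\{k\}:P(\bar x)$ for every $k\in X$ / $\Gamma\Rightarrow\Delta,X:P(\bar x)$. $(\Rightarrow\wedge)$: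 $\Gamma\Rightarrow\Delta,X:\varphi$ and $\Gamma\Rightarrow\Delta,X:\psi$ / $\Gamma\Rightarrow\Delta,X:\varphi\wedge\psi$. $(\wedge\Rightarrow)$: $X:\varphi,X:\psi,\Gamma\Rightarrow\Delta$ / $X:\varphi\wedge\psi,\Gamma\Rightarrow\Delta$. $(\Rightarrow\veebar)$: $\Gamma\Rightarrow\Delta,X:\varphi,X:\psi$ / $\Gamma\Rightarrow\Delta,X:\varphi\veebar\psi$. $(\veebar\Rightarrow)$: $X:\varphi,\Gamma\Rightarrow\Delta$ and $X:\psi,\Gamma\Rightarrow\Delta$ / $X:\varphi\veebar\psi,\Gamma\Rightarrow\Delta$. $(\Rightarrow\to)$: $Y:\varphi,\Gamma\Rightarrow\Delta,Y:\psi$ for every label $Y\subseteq X$ / $\Gamma\Rightarrow\Delta,X:\varphi\to\psi$. $(\to\Rightarrow)$, for a label $Y\subseteq X$: $X:\varphi\to\psi,\Gamma\Rightarrow\Delta,Y:\varphi$ and $Y:\psi,X:\varphi\to\psi,\Gamma\Rightarrow\Delta$ / $X:\varphi\to\psi,\Gamma\Rightarrow\Delta$. $(\Rightarrow\forall)$: $\Gamma\Rightarrow\Delta,X:\varphi[z/x]$ / $\Gamma\Rightarrow\Delta,X:\forall x\varphi$, with $z$ not occurring in the conclusion. $(\forall\Rightarrow)$: $X:\varphi[y/x],X:\forall x\varphi,\Gamma\Rightarrow\Delta$ / $X:\forall x\varphi,\Gamma\Rightarrow\Delta$ ($y$ arbitrary). $(\Rightarrow\bar\exists)$: $\Gamma\Rightarrow\Delta,X:\bar\exists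 x\varphi,X:\varphi[y/x]$ / $\Gamma\Rightarrow\Delta,X:\bar\exists x\varphi$ ($y$ arbitrary). $(\bar\exists\Rightarrow)$: $X:\varphi[z/x],\Gamma\Rightarrow\Delta$ / $X:\bar\exists x\varphi,\Gamma\Rightarrow\Delta$, with $z$ not occurring in the conclusion. A derivation is a finite tree of sequents built from initial sequents by these rules; a sequent is derivable if it is the root of a derivation. -}

module Defs where

open import Data.Nat using (ℕ; suc; _⊔_; _≟_; _<_)
open import Data.List using (List; []; _∷_; _++_; map; filter; foldr; concatMap)
open import Data.List.Relation.Unary.AllPairs using (AllPairs; []; _∷_)
open import Data.List.Relation.Unary.All using ([])
open import Data.List.Membership.Propositional using (_∈_; _∉_)
open import Data.List.Membership.DecPropositional _≟_ using (_∈?_)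
open import Data.List.Relation.Binary.Permutation.Propositional using (_↭_)
open import Data.Vec as Vec using (Vec)
open import Data.Bool using (if_then_else_)
open import Relation.Nullary using (yes; no; ¬?; does)
open import Relation.Binary.PropositionalEquality using (_≢_)
open import Function using (id)

Var : Set
Var = ℕ

record PredSym : Set where
  constructor pred
  field
    name  : ℕ
    arity : ℕ

infixr 6 _∧'_
infixr 5 _⩒_
infixr 4 _⇒'_

data Formula : Set where
  atom  : (P : PredSym) → Vec Var (PredSym.arity P) → Formula
  ⊥'    : Formula
  _⇒'_  : Formula → Formula → Formula
  _∧'_  : Formula → Formula → Formula
  _⩒_   : Formula → Formula → Formula   -- inquisitive disjunction
  ∀'    : Var → Formula → Formula
  ∃'    : Var → Formula → Formula       -- inquisitive existential

fv : Formula → List Var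
fv (atom P xs) = Vec.toList xs
fv ⊥'          = []
fv (φ ⇒' ψ)    = fv φ ++ fv ψ
fv (φ ∧' ψ)    = fv φ ++ fv ψ
fv (φ ⩒ ψ)     = fv φ ++ fv ψ
fv (∀' x φ)    = filter (λ y → ¬? (y ≟ x)) (fv φ)
fv (∃' x φ)    = filter (λ y → ¬? (y ≟ x)) (fv φ)

vars : Formula → List Var
vars (atom P xs) = Vec.toList xs
vars ⊥'          = []
vars (φ ⇒' ψ)    = vars φ ++ vars ψ
vars (φ ∧' ψ)    = vars φ ++ vars ψ
vars (φ ⩒ ψ)     = vars φ ++ vars ψ
vars (∀' x φ)    = x ∷ vars φ
vars (∃' x φ)    = x ∷ vars φ

update : (Var → Var) → Var → Var → (Var → Var)
update σ x z y with y ≟ x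
... | yes _ = z
... | no  _ = σ y

maxL : List ℕ → ℕ
maxL = foldr _⊔_ 0

-- new name for a binder x of body φ under σ: keep x unless it would
-- capture one of the substituted free variables, otherwise take a fresh one
binder : (Var → Var) → Var → Formula → Var
binder σ x φ =
  let ys = map σ (filter (λ y → ¬? (y ≟ x)) (fv φ))
  in if does (x ∈? ys) then suc (maxL ys) else x

sub : (Var → Var) → Formula → Formula
sub σ (atom P xs) = atom P (Vec.map σ xs)
sub σ ⊥'          = ⊥'
sub σ (φ ⇒' ψ)    = sub σ φ ⇒' sub σ ψ
sub σ (φ ∧' ψ)    = sub σ φ ∧' sub σ ψ
sub σ (φ ⩒ ψ)     = sub σ φ ⩒ sub σ ψ
sub σ (∀' x φ)    = let x' = binder σ x φ in ∀' x' (sub (update σ x x') φ)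
sub σ (∃' x φ)    = let x' = binder σ x φ in ∃' x' (sub (update σ x x') φ)

_[_/_] : Formula → Var → Var → Formula
φ [ z / x ] = sub (update id x z) φ

-- Labels: nonempty finite subsets of ω, canonically as strictly
-- increasing nonempty lists

record Label : Set where
  constructor label
  field
    elems    : List ℕ
    sorted   : AllPairs _<_ elems
    nonempty : elems ≢ []
open Label public

singleton : ℕ → Label
singleton k = label (k ∷ []) ([] ∷ []) (λ ())

_⊆L_ : Label → Label → Set
Y ⊆L X = ∀ {k} → k ∈ elems Y → k ∈ elems X

record LFormula : Set where
  constructor _∶_
  field
    lab  : Label
    form : Formula
open LFormula public

infix 3 _∶_

occ : List LFormula → List LFormula → List Var
occ Γ Δ = concatMap (λ A → vars (form A)) (Γ ++ Δ)

-- The calculus G(FBInqBQ).  Sequents are pairs of finite multisets,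
-- represented as lists taken up to permutation (rule `perm`).

infix 2 _⊢_

data _⊢_ : List LFormula → List LFormula → Set where
  perm : ∀ {Γ Γ' Δ Δ'} → Γ ↭ Γ' → Δ ↭ Δ' → Γ ⊢ Δ → Γ' ⊢ Δ'
  idax : ∀ {X Y P xs Γ Δ} → Y ⊆L X →
         (X ∶ atom P xs) ∷ Γ ⊢ (Y ∶ atom P xs) ∷ Δ
  ⊥⇒   : ∀ {X Γ Δ} → (X ∶ ⊥') ∷ Γ ⊢ Δ
  ⇒at  : ∀ {X P xs Γ Δ} →
         (∀ k → k ∈ elems X → Γ ⊢ (singleton k ∶ atom P xs) ∷ Δ) →
         Γ ⊢ (X ∶ atom P xs) ∷ Δ
  ⇒∧   : ∀ {X φ ψ Γ Δ} → Γ ⊢ (X ∶ φ) ∷ Δ → Γ ⊢ (X ∶ ψ) ∷ Δ →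
         Γ ⊢ (X ∶ φ ∧' ψ) ∷ Δ
  ∧⇒   : ∀ {X φ ψ Γ Δ} → (X ∶ φ) ∷ (X ∶ ψ) ∷ Γ ⊢ Δ →
         (X ∶ φ ∧' ψ) ∷ Γ ⊢ Δ
  ⇒⩒   : ∀ {X φ ψ Γ Δ} → Γ ⊢ (X ∶ φ) ∷ (X ∶ ψ) ∷ Δ →
         Γ ⊢ (X ∶ φ ⩒ ψ) ∷ Δ
  ⩒⇒   : ∀ {X φ ψ Γ Δ} → (X ∶ φ) ∷ Γ ⊢ Δ → (X ∶ ψ) ∷ Γ ⊢ Δ →
         (X ∶ φ ⩒ ψ) ∷ Γ ⊢ Δ
  ⇒→   : ∀ {X φ ψ Γ Δ} →
         (∀ Y → Y ⊆L X → (Y ∶ φ) ∷ Γ ⊢ (Y ∶ ψ) ∷ Δ) →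
         Γ ⊢ (X ∶ φ ⇒' ψ) ∷ Δ
  →⇒   : ∀ {X Y φ ψ Γ Δ} → Y ⊆L X →
         (X ∶ φ ⇒' ψ) ∷ Γ ⊢ (Y ∶ φ) ∷ Δ →
         (Y ∶ ψ) ∷ (X ∶ φ ⇒' ψ) ∷ Γ ⊢ Δ →
         (X ∶ φ ⇒' ψ) ∷ Γ ⊢ Δ
  ⇒∀   : ∀ {X x z φ Γ Δ} → z ∉ occ Γ ((X ∶ ∀' x φ) ∷ Δ) →
         Γ ⊢ (X ∶ φ [ z / x ]) ∷ Δ →
         Γ ⊢ (X ∶ ∀' x φ) ∷ Δ
  ∀⇒   : ∀ {X x y φ Γ Δ} →
         (X ∶ φ [ y / x ]) ∷ (X ∶ ∀' x φ) ∷ Γ ⊢ Δ →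
         (X ∶ ∀' x φ) ∷ Γ ⊢ Δ
  ⇒∃   : ∀ {X x y φ Γ Δ} →
         Γ ⊢ (X ∶ ∃' x φ) ∷ (X ∶ φ [ y / x ]) ∷ Δ →
         Γ ⊢ (X ∶ ∃' x φ) ∷ Δ
  ∃⇒   : ∀ {X x z φ Γ Δ} → z ∉ occ ((X ∶ ∃' x φ) ∷ Γ) Δ →
         (X ∶ φ [ z / x ]) ∷ Γ ⊢ Δ →
         (X ∶ ∃' x φ) ∷ Γ ⊢ Δ

{-# OPTIONS --safe #-}
-- Cut is eliminated by induction on the size of the cut formula and, inside
-- that, on the heights of the two derivations.  The induction on heights only
-- works if weakening, renaming of eigenvariables and inversion of rules preserve
-- height, which is awkward for the calculus as given: its principal formulas
-- vanish from the premises and its eigenvariables are concrete names.  So the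
-- argument runs in an equivalent calculus whose rules pick the principal formula
-- by membership and keep it in the premises, and whose derivations carry a
-- shape (an infinitely branching tree) as height.  One simulation lemma yields all
-- the needed structural rules with the same shape: a derivation of Γ ⇒ Δ can be
-- replayed on any Γ′ ⇒ Δ′ that covers Γ ⇒ Δ up to a renaming of free variables,
-- where α-equivalence is decided on locally nameless forms and a formula is also
-- covered by what a rule would decompose it into.  In a principal cut one first
-- cuts the cut formula out of the premises (smaller shapes), then cuts on its
-- immediate subformulas or instances (smaller size).
module Submission where

open import Defs
open import Data.Nat using (ℕ; suc; _+_; _≤_; _<_; _≟_; s≤s)
open import Data.Nat.Properties using (≤-refl; ≤-trans; m≤m⊔n; m≤n⊔m; <-irrefl; n≮n; n≤1+n; m+n≤o⇒m≤o; m+n≤o⇒n≤o)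
open import Data.List using (List; []; _∷_; _++_; map)
open import Data.List.Relation.Unary.Any using (here; there)
open import Data.List.Membership.Propositional using (_∈_; _∉_; lose)
open import Data.List.Membership.Propositional.Properties using (∈-filter⁺; ∈-map⁺; ∈-++⁺ˡ; ∈-++⁺ʳ; ∈-concatMap⁺; ∈-∃++)
open import Data.List.Relation.Binary.Permutation.Propositional using (_↭_; ↭-refl; ↭-sym)
open import Data.List.Relation.Binary.Permutation.Propositional.Properties using (∈-resp-↭; shift)
open import Data.List.Relation.Binary.Subset.Propositional using (_⊆_)
open import Data.List.Relation.Binary.Subset.Propositional.Properties using (⊆-refl; ∷⁺ʳ; ∈-∷⁺ʳ; ++⁺; concatMap⁺; xs⊆xs++ys; xs⊆ys++xs)
open import Data.List.Membership.DecPropositional _≟_ using (_∈?_)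
open import Data.Vec as Vec using (Vec)
open import Data.Vec.Properties using (map-id; map-∘; ∷-injective)
open import Data.Vec.Membership.Propositional renaming (_∈_ to _∈ᵥ_) using ()
open import Data.Vec.Membership.Propositional.Properties using (fromAny; ∈-toList⁺)
open import Data.Vec.Relation.Unary.Any using (here; there)
import Data.Vec.Relation.Unary.Any.Properties as Anyᵥ
open import Data.Product using (∃; ∃₂; _×_; _,_; -,_; proj₁; proj₂; map₁; map₂)
open import Data.Empty using (⊥-elim)
open import Function using (id; _∘_; case_of_)
open import Relation.Nullary using (yes; no; ¬_; ¬?)
open import Relation.Binary.PropositionalEquality using (_≡_; refl; sym; trans; cong; cong₂; subst; _≢_; module ≡-Reasoning)

variable
  V W : Set
  n d k l : ℕ
  x y z : Var
  φ ψ : Formula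
  σ : ℕ → ℕ

map-cong-∈ : {f g : V → W} (xs : Vec V n) → (∀ {a} → a ∈ᵥ xs → f a ≡ g a) → Vec.map f xs ≡ Vec.map g xs
map-cong-∈ Vec.[]       f≡g = refl
map-cong-∈ (x Vec.∷ xs) f≡g = cong₂ Vec._∷_ (f≡g (here refl)) (map-cong-∈ xs (f≡g ∘ there))

∈-map⁻ : {f : V → W} {b : W} (xs : Vec V n) → b ∈ᵥ Vec.map f xs → ∃ λ a → a ∈ᵥ xs × b ≡ f a
∈-map⁻ xs = fromAny ∘ Anyᵥ.map⁻

-- Locally nameless formulas

data Name : Set where
  free bound : ℕ → Name

map-free-injective : {xs ys : Vec ℕ n} → Vec.map free xs ≡ Vec.map free ys → xs ≡ ys
map-free-injective {xs = Vec.[]}     {Vec.[]}     _ = refl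
map-free-injective {xs = x Vec.∷ xs} {y Vec.∷ ys} e with ∷-injective e
... | refl , e′ = cong (x Vec.∷_) (map-free-injective e′)

data Nameless : Set where
  at         : (P : PredSym) → Vec Name (PredSym.arity P) → Nameless
  bot        : Nameless
  imp and or : Nameless → Nameless → Nameless
  all ex     : Nameless → Nameless

variable
  a : Name
  t u : Nameless

mapNames : (ℕ → Name → Name) → ℕ → Nameless → Nameless
mapNames f d (at P ns) = at P (Vec.map (f d) ns)
mapNames f d bot       = bot
mapNames f d (imp t u) = imp (mapNames f d t) (mapNames f d u)
mapNames f d (and t u) = and (mapNames f d t) (mapNames f d u)
mapNames f d (or t u)  = or (mapNames f d t) (mapNames f d u)
mapNames f d (all t)   = all (mapNames f (suc d) t)
mapNames f d (ex t)    = ex (mapNames f (suc d) t)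

-- OccursAt a d l t: a occurs in t under l binders, t itself lying under d binders.
data OccursAt (a : Name) : ℕ → ℕ → Nameless → Set where
  in-at   : ∀ {P ns} → a ∈ᵥ ns → OccursAt a d d (at P ns)
  in-imp₁ : OccursAt a d l t → OccursAt a d l (imp t u)
  in-imp₂ : OccursAt a d l u → OccursAt a d l (imp t u)
  in-and₁ : OccursAt a d l t → OccursAt a d l (and t u)
  in-and₂ : OccursAt a d l u → OccursAt a d l (and t u)
  in-or₁  : OccursAt a d l t → OccursAt a d l (or t u)
  in-or₂  : OccursAt a d l u → OccursAt a d l (or t u)
  in-all  : OccursAt a (suc d) l t → OccursAt a d l (all t)
  in-ex   : OccursAt a (suc d) l t → OccursAt a d l (ex t)

data Occurs (a : Name) : Nameless → Set where
  in-at   : ∀ {P ns} → a ∈ᵥ ns → Occurs a (at P ns)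
  in-imp₁ : Occurs a t → Occurs a (imp t u)
  in-imp₂ : Occurs a u → Occurs a (imp t u)
  in-and₁ : Occurs a t → Occurs a (and t u)
  in-and₂ : Occurs a u → Occurs a (and t u)
  in-or₁  : Occurs a t → Occurs a (or t u)
  in-or₂  : Occurs a u → Occurs a (or t u)
  in-all  : Occurs a t → Occurs a (all t)
  in-ex   : Occurs a t → Occurs a (ex t)

occursAt⇒occurs : OccursAt a d l t → Occurs a t
occursAt⇒occurs (in-at m)   = in-at m
occursAt⇒occurs (in-imp₁ o) = in-imp₁ (occursAt⇒occurs o)
occursAt⇒occurs (in-imp₂ o) = in-imp₂ (occursAt⇒occurs o)
occursAt⇒occurs (in-and₁ o) = in-and₁ (occursAt⇒occurs o)
occursAt⇒occurs (in-and₂ o) = in-and₂ (occursAt⇒occurs o)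
occursAt⇒occurs (in-or₁ o)  = in-or₁ (occursAt⇒occurs o)
occursAt⇒occurs (in-or₂ o)  = in-or₂ (occursAt⇒occurs o)
occursAt⇒occurs (in-all o)  = in-all (occursAt⇒occurs o)
occursAt⇒occurs (in-ex o)   = in-ex (occursAt⇒occurs o)

mapNames-cong : ∀ (f g : ℕ → Name → Name) d t →
  (∀ {l a} → OccursAt a d l t → f l a ≡ g l a) → mapNames f d t ≡ mapNames g d t
mapNames-cong f g d (at P ns) f≡g = cong (at P) (map-cong-∈ ns (f≡g ∘ in-at))
mapNames-cong f g d bot       f≡g = refl
mapNames-cong f g d (imp t u) f≡g =
  cong₂ imp (mapNames-cong f g d t (f≡g ∘ in-imp₁)) (mapNames-cong f g d u (f≡g ∘ in-imp₂))
mapNames-cong f g d (and t u) f≡g =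
  cong₂ and (mapNames-cong f g d t (f≡g ∘ in-and₁)) (mapNames-cong f g d u (f≡g ∘ in-and₂))
mapNames-cong f g d (or t u)  f≡g =
  cong₂ or (mapNames-cong f g d t (f≡g ∘ in-or₁)) (mapNames-cong f g d u (f≡g ∘ in-or₂))
mapNames-cong f g d (all t)   f≡g = cong all (mapNames-cong f g (suc d) t (f≡g ∘ in-all))
mapNames-cong f g d (ex t)    f≡g = cong ex (mapNames-cong f g (suc d) t (f≡g ∘ in-ex))

mapNames-∘ : ∀ (f g : ℕ → Name → Name) d t →
  mapNames f d (mapNames g d t) ≡ mapNames (λ l → f l ∘ g l) d t
mapNames-∘ f g d (at P ns) = cong (at P) (sym (map-∘ (f d) (g d) ns))
mapNames-∘ f g d bot       = refl
mapNames-∘ f g d (imp t u) = cong₂ imp (mapNames-∘ f g d t) (mapNames-∘ f g d u)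
mapNames-∘ f g d (and t u) = cong₂ and (mapNames-∘ f g d t) (mapNames-∘ f g d u)
mapNames-∘ f g d (or t u)  = cong₂ or (mapNames-∘ f g d t) (mapNames-∘ f g d u)
mapNames-∘ f g d (all t)   = cong all (mapNames-∘ f g (suc d) t)
mapNames-∘ f g d (ex t)    = cong ex (mapNames-∘ f g (suc d) t)

mapNames-∘-cong : ∀ (f g f′ g′ : ℕ → Name → Name) d t →
  (∀ {l a} → OccursAt a d l t → f l (g l a) ≡ f′ l (g′ l a)) →
  mapNames f d (mapNames g d t) ≡ mapNames f′ d (mapNames g′ d t)
mapNames-∘-cong f g f′ g′ d t f∘g≡f′∘g′ =
  trans (mapNames-∘ f g d t) (trans (mapNames-cong _ _ d t f∘g≡f′∘g′) (sym (mapNames-∘ f′ g′ d t)))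

mapNames-id : ∀ d t → mapNames (λ _ → id) d t ≡ t
mapNames-id d (at P ns) = cong (at P) (map-id ns)
mapNames-id d bot       = refl
mapNames-id d (imp t u) = cong₂ imp (mapNames-id d t) (mapNames-id d u)
mapNames-id d (and t u) = cong₂ and (mapNames-id d t) (mapNames-id d u)
mapNames-id d (or t u)  = cong₂ or (mapNames-id d t) (mapNames-id d u)
mapNames-id d (all t)   = cong all (mapNames-id (suc d) t)
mapNames-id d (ex t)    = cong ex (mapNames-id (suc d) t)

mapNames-const : ∀ (g : Name → Name) d e t → mapNames (λ _ → g) d t ≡ mapNames (λ _ → g) e t
mapNames-const g d e (at P ns) = refl
mapNames-const g d e bot       = refl
mapNames-const g d e (imp t u) = cong₂ imp (mapNames-const g d e t) (mapNames-const g d e u)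
mapNames-const g d e (and t u) = cong₂ and (mapNames-const g d e t) (mapNames-const g d e u)
mapNames-const g d e (or t u)  = cong₂ or (mapNames-const g d e t) (mapNames-const g d e u)
mapNames-const g d e (all t)   = cong all (mapNames-const g (suc d) (suc e) t)
mapNames-const g d e (ex t)    = cong ex (mapNames-const g (suc d) (suc e) t)

occursAt-mapNames⁻ : ∀ (f : ℕ → Name → Name) t → OccursAt a d l (mapNames f d t) →
  ∃ λ a′ → OccursAt a′ d l t × a ≡ f l a′
occursAt-mapNames⁻ f (at P ns) (in-at m)   = map₂ (map₁ in-at) (∈-map⁻ ns m)
occursAt-mapNames⁻ f (imp t u) (in-imp₁ o) = map₂ (map₁ in-imp₁) (occursAt-mapNames⁻ f t o)
occursAt-mapNames⁻ f (imp t u) (in-imp₂ o) = map₂ (map₁ in-imp₂) (occursAt-mapNames⁻ f u o)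
occursAt-mapNames⁻ f (and t u) (in-and₁ o) = map₂ (map₁ in-and₁) (occursAt-mapNames⁻ f t o)
occursAt-mapNames⁻ f (and t u) (in-and₂ o) = map₂ (map₁ in-and₂) (occursAt-mapNames⁻ f u o)
occursAt-mapNames⁻ f (or t u)  (in-or₁ o)  = map₂ (map₁ in-or₁) (occursAt-mapNames⁻ f t o)
occursAt-mapNames⁻ f (or t u)  (in-or₂ o)  = map₂ (map₁ in-or₂) (occursAt-mapNames⁻ f u o)
occursAt-mapNames⁻ f (all t)   (in-all o)  = map₂ (map₁ in-all) (occursAt-mapNames⁻ f t o)
occursAt-mapNames⁻ f (ex t)    (in-ex o)   = map₂ (map₁ in-ex) (occursAt-mapNames⁻ f t o)

occurs-mapNames⁻ : ∀ (f : ℕ → Name → Name) d t → Occurs a (mapNames f d t) →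
  ∃₂ λ a′ l → Occurs a′ t × a ≡ f l a′
occurs-mapNames⁻ f d (at P ns) (in-at m)   = map₂ (λ (m′ , e) → d , in-at m′ , e) (∈-map⁻ ns m)
occurs-mapNames⁻ f d (imp t u) (in-imp₁ o) = map₂ (map₂ (map₁ in-imp₁)) (occurs-mapNames⁻ f d t o)
occurs-mapNames⁻ f d (imp t u) (in-imp₂ o) = map₂ (map₂ (map₁ in-imp₂)) (occurs-mapNames⁻ f d u o)
occurs-mapNames⁻ f d (and t u) (in-and₁ o) = map₂ (map₂ (map₁ in-and₁)) (occurs-mapNames⁻ f d t o)
occurs-mapNames⁻ f d (and t u) (in-and₂ o) = map₂ (map₂ (map₁ in-and₂)) (occurs-mapNames⁻ f d u o)
occurs-mapNames⁻ f d (or t u)  (in-or₁ o)  = map₂ (map₂ (map₁ in-or₁)) (occurs-mapNames⁻ f d t o)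
occurs-mapNames⁻ f d (or t u)  (in-or₂ o)  = map₂ (map₂ (map₁ in-or₂)) (occurs-mapNames⁻ f d u o)
occurs-mapNames⁻ f d (all t)   (in-all o)  = map₂ (map₂ (map₁ in-all)) (occurs-mapNames⁻ f _ t o)
occurs-mapNames⁻ f d (ex t)    (in-ex o)   = map₂ (map₂ (map₁ in-ex)) (occurs-mapNames⁻ f _ t o)

occursAt-suc⁻ : ∀ t → OccursAt a (suc d) l t → ∃ λ l′ → l ≡ suc l′ × OccursAt a d l′ t
occursAt-suc⁻ (at P ns) (in-at m)   = _ , refl , in-at m
occursAt-suc⁻ (imp t u) (in-imp₁ o) = map₂ (map₂ in-imp₁) (occursAt-suc⁻ t o)
occursAt-suc⁻ (imp t u) (in-imp₂ o) = map₂ (map₂ in-imp₂) (occursAt-suc⁻ u o)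
occursAt-suc⁻ (and t u) (in-and₁ o) = map₂ (map₂ in-and₁) (occursAt-suc⁻ t o)
occursAt-suc⁻ (and t u) (in-and₂ o) = map₂ (map₂ in-and₂) (occursAt-suc⁻ u o)
occursAt-suc⁻ (or t u)  (in-or₁ o)  = map₂ (map₂ in-or₁) (occursAt-suc⁻ t o)
occursAt-suc⁻ (or t u)  (in-or₂ o)  = map₂ (map₂ in-or₂) (occursAt-suc⁻ u o)
occursAt-suc⁻ (all t)   (in-all o)  = map₂ (map₂ in-all) (occursAt-suc⁻ t o)
occursAt-suc⁻ (ex t)    (in-ex o)   = map₂ (map₂ in-ex) (occursAt-suc⁻ t o)

renameName : (ℕ → ℕ) → Name → Name
renameName σ (free v)  = free (σ v)
renameName σ (bound k) = bound k

bindName : ℕ → ℕ → Name → Name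
bindName x l (free v) with v ≟ x
... | yes _ = bound l
... | no  _ = free v
bindName x l (bound k) = bound k

instName : ℕ → ℕ → Name → Name
instName z l (free v) = free v
instName z l (bound k) with k ≟ l
... | yes _ = free z
... | no  _ = bound k

rename : (ℕ → ℕ) → Nameless → Nameless
rename σ = mapNames (λ _ → renameName σ) 0

renameBody : (ℕ → ℕ) → Nameless → Nameless
renameBody σ = mapNames (λ _ → renameName σ) 1

bind : ℕ → Nameless → Nameless
bind x = mapNames (bindName x) 0

inst : ℕ → Nameless → Nameless
inst z = mapNames (instName z) 0

-- Locally nameless form: bound variables become de Bruijn indices, so that
-- α-equivalent formulas have the same image.
nameless : Formula → Nameless
nameless (atom P xs) = at P (Vec.map free xs)
nameless ⊥'          = bot
nameless (φ ⇒' ψ)    = imp (nameless φ) (nameless ψ)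
nameless (φ ∧' ψ)    = and (nameless φ) (nameless ψ)
nameless (φ ⩒ ψ)     = or (nameless φ) (nameless ψ)
nameless (∀' x φ)    = all (bind x (nameless φ))
nameless (∃' x φ)    = ex (bind x (nameless φ))

rename-cong : ∀ (σ ρ : ℕ → ℕ) t → (∀ v → Occurs (free v) t → σ v ≡ ρ v) → rename σ t ≡ rename ρ t
rename-cong σ ρ t σ≡ρ = mapNames-cong _ _ 0 t agree
  where
  agree : ∀ {l a} → OccursAt a 0 l t → renameName σ a ≡ renameName ρ a
  agree {a = free v}  o = cong free (σ≡ρ v (occursAt⇒occurs o))
  agree {a = bound k} o = refl

rename-id : ∀ t → rename id t ≡ t
rename-id t = trans (mapNames-cong _ _ 0 t identity) (mapNames-id 0 t)
  where
  identity : ∀ {l a} → OccursAt a 0 l t → renameName id a ≡ a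
  identity {a = free v}  _ = refl
  identity {a = bound k} _ = refl

LocallyClosed : Nameless → Set
LocallyClosed t = ∀ {l k} → OccursAt (bound k) 0 l t → k < l

bind-locallyClosed : ∀ x t → LocallyClosed t → OccursAt (bound k) 1 l (bind x t) → k < l
bind-locallyClosed x t closed o with occursAt-suc⁻ (bind x t) o
... | l′ , refl , o′ with occursAt-mapNames⁻ (bindName x) t o′
... | bound k′ , o″ , refl = ≤-trans (closed o″) (n≤1+n l′)
... | free v   , o″ , e    with v ≟ x | e
...   | yes _ | refl = ≤-refl
...   | no  _ | ()

nameless-locallyClosed : ∀ φ → LocallyClosed (nameless φ)
nameless-locallyClosed (atom P xs) (in-at m) with ∈-map⁻ xs m
... | _ , _ , ()
nameless-locallyClosed (φ ⇒' ψ) (in-imp₁ o) = nameless-locallyClosed φ o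
nameless-locallyClosed (φ ⇒' ψ) (in-imp₂ o) = nameless-locallyClosed ψ o
nameless-locallyClosed (φ ∧' ψ) (in-and₁ o) = nameless-locallyClosed φ o
nameless-locallyClosed (φ ∧' ψ) (in-and₂ o) = nameless-locallyClosed ψ o
nameless-locallyClosed (φ ⩒ ψ)  (in-or₁ o)  = nameless-locallyClosed φ o
nameless-locallyClosed (φ ⩒ ψ)  (in-or₂ o)  = nameless-locallyClosed ψ o
nameless-locallyClosed (∀' x φ) (in-all o)  = bind-locallyClosed x (nameless φ) (nameless-locallyClosed φ) o
nameless-locallyClosed (∃' x φ) (in-ex o)   = bind-locallyClosed x (nameless φ) (nameless-locallyClosed φ) o

free-bind⁻ : ∀ x t v → Occurs (free v) (bind x t) → Occurs (free v) t × v ≢ x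
free-bind⁻ x t v o with occurs-mapNames⁻ (bindName x) 0 t o
... | bound k , _ , _ , ()
... | free w  , _ , o′ , e with w ≟ x | e
...   | yes _  | ()
...   | no w≢x | refl = o′ , w≢x

free-nameless⊆fv : ∀ φ {v} → Occurs (free v) (nameless φ) → v ∈ fv φ
free-nameless⊆fv (atom P xs) (in-at m) with ∈-map⁻ xs m
... | _ , m′ , refl = ∈-toList⁺ m′
free-nameless⊆fv (φ ⇒' ψ) (in-imp₁ o) = ∈-++⁺ˡ (free-nameless⊆fv φ o)
free-nameless⊆fv (φ ⇒' ψ) (in-imp₂ o) = ∈-++⁺ʳ (fv φ) (free-nameless⊆fv ψ o)
free-nameless⊆fv (φ ∧' ψ) (in-and₁ o) = ∈-++⁺ˡ (free-nameless⊆fv φ o)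
free-nameless⊆fv (φ ∧' ψ) (in-and₂ o) = ∈-++⁺ʳ (fv φ) (free-nameless⊆fv ψ o)
free-nameless⊆fv (φ ⩒ ψ)  (in-or₁ o)  = ∈-++⁺ˡ (free-nameless⊆fv φ o)
free-nameless⊆fv (φ ⩒ ψ)  (in-or₂ o)  = ∈-++⁺ʳ (fv φ) (free-nameless⊆fv ψ o)
free-nameless⊆fv (∀' x φ) {v} (in-all o) with free-bind⁻ x (nameless φ) v o
... | o′ , v≢x = ∈-filter⁺ (λ y → ¬? (y ≟ x)) (free-nameless⊆fv φ o′) v≢x
free-nameless⊆fv (∃' x φ) {v} (in-ex o) with free-bind⁻ x (nameless φ) v o
... | o′ , v≢x = ∈-filter⁺ (λ y → ¬? (y ≟ x)) (free-nameless⊆fv φ o′) v≢x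

free-nameless⊆vars : ∀ φ {v} → Occurs (free v) (nameless φ) → v ∈ vars φ
free-nameless⊆vars (atom P xs) (in-at m) with ∈-map⁻ xs m
... | _ , m′ , refl = ∈-toList⁺ m′
free-nameless⊆vars (φ ⇒' ψ) (in-imp₁ o) = ∈-++⁺ˡ (free-nameless⊆vars φ o)
free-nameless⊆vars (φ ⇒' ψ) (in-imp₂ o) = ∈-++⁺ʳ (vars φ) (free-nameless⊆vars ψ o)
free-nameless⊆vars (φ ∧' ψ) (in-and₁ o) = ∈-++⁺ˡ (free-nameless⊆vars φ o)
free-nameless⊆vars (φ ∧' ψ) (in-and₂ o) = ∈-++⁺ʳ (vars φ) (free-nameless⊆vars ψ o)
free-nameless⊆vars (φ ⩒ ψ)  (in-or₁ o)  = ∈-++⁺ˡ (free-nameless⊆vars φ o)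
free-nameless⊆vars (φ ⩒ ψ)  (in-or₂ o)  = ∈-++⁺ʳ (vars φ) (free-nameless⊆vars ψ o)
free-nameless⊆vars (∀' x φ) {v} (in-all o) = there (free-nameless⊆vars φ (proj₁ (free-bind⁻ x _ v o)))
free-nameless⊆vars (∃' x φ) {v} (in-ex o)  = there (free-nameless⊆vars φ (proj₁ (free-bind⁻ x _ v o)))

≤-maxL : ∀ {v} xs → v ∈ xs → v ≤ maxL xs
≤-maxL (x ∷ xs) (here refl) = m≤m⊔n x (maxL xs)
≤-maxL (x ∷ xs) (there v∈) = ≤-trans (≤-maxL xs v∈) (m≤n⊔m x (maxL xs))

fresh : List ℕ → ℕ
fresh xs = suc (maxL xs)

fresh∉ : ∀ xs → fresh xs ∉ xs
fresh∉ xs fresh∈ = n≮n (maxL xs) (≤-maxL xs fresh∈)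

binder-avoids : ∀ σ x φ → binder σ x φ ∉ map σ (fv (∀' x φ))
binder-avoids σ x φ with x ∈? map σ (fv (∀' x φ))
... | yes _   = fresh∉ _
... | no  x∉ = x∉

vars⊆occ : ∀ Γ Δ {A} → A ∈ Γ ++ Δ → vars (form A) ⊆ occ Γ Δ
vars⊆occ Γ Δ A∈ v∈ = ∈-concatMap⁺ (λ A → vars (form A)) (lose A∈ v∈)

∉occ-mono : ∀ Γ Δ {Γ′ Δ′ z} → Γ ⊆ Γ′ → Δ ⊆ Δ′ → z ∉ occ Γ′ Δ′ → z ∉ occ Γ Δ
∉occ-mono Γ Δ Γ⊆ Δ⊆ z∉ = z∉ ∘ concatMap⁺ (λ A → vars (form A)) (++⁺ Γ⊆ Δ⊆)

fresh-member : ∀ Γ Δ {z A} → z ∉ occ Γ Δ → A ∈ Γ ++ Δ → ¬ Occurs (free z) (nameless (form A))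
fresh-member Γ Δ {A = A} z∉ A∈ o = z∉ (vars⊆occ Γ Δ A∈ (free-nameless⊆vars (form A) o))

fresh-∀-body : ∀ Γ Δ {z X x φ} → z ∉ occ Γ Δ → (X ∶ ∀' x φ) ∈ Δ → ¬ Occurs (free z) (bind x (nameless φ))
fresh-∀-body Γ Δ z∉ p o = fresh-member Γ Δ z∉ (∈-++⁺ʳ Γ p) (in-all o)

fresh-∃-body : ∀ Γ Δ {z X x φ} → z ∉ occ Γ Δ → (X ∶ ∃' x φ) ∈ Γ → ¬ Occurs (free z) (bind x (nameless φ))
fresh-∃-body Γ Δ z∉ p o = fresh-member Γ Δ z∉ (∈-++⁺ˡ p) (in-ex o)

update-≡ : ∀ σ z w → update σ z w z ≡ w
update-≡ σ z w with z ≟ z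
... | yes _   = refl
... | no  z≢z = ⊥-elim (z≢z refl)

update-≢ : ∀ σ {z} w {v} → v ≢ z → update σ z w v ≡ σ v
update-≢ σ {z} w {v} v≢z with v ≟ z
... | yes v≡z = ⊥-elim (v≢z v≡z)
... | no  _   = refl

rename-update-fresh : ∀ σ z w t → ¬ Occurs (free z) t → rename (update σ z w) t ≡ rename σ t
rename-update-fresh σ z w t z∉t =
  rename-cong _ _ t (λ v o → update-≢ σ w (λ { refl → z∉t o }))

bind-rename : ∀ σ x x′ t → (∀ v → Occurs (free v) t → v ≢ x → σ v ≢ x′) →
  bind x′ (rename (update σ x x′) t) ≡ rename σ (bind x t)
bind-rename σ x x′ t no-capture = mapNames-∘-cong _ _ _ _ 0 t commute
  where
  commute : ∀ {l a} → OccursAt a 0 l t →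
    bindName x′ l (renameName (update σ x x′) a) ≡ renameName σ (bindName x l a)
  commute {a = bound k} o = refl
  commute {l} {free v} o with v ≟ x
  ... | yes refl with x′ ≟ x′
  ...   | yes _   = refl
  ...   | no  ≢x′ = ⊥-elim (≢x′ refl)
  commute {l} {free v} o | no v≢x with σ v ≟ x′
  ...   | yes σv≡x′ = ⊥-elim (no-capture v (occursAt⇒occurs o) v≢x σv≡x′)
  ...   | no  _     = refl

nameless-sub : ∀ σ φ → nameless (sub σ φ) ≡ rename σ (nameless φ)
nameless-sub-body : ∀ σ x φ →
  bind (binder σ x φ) (nameless (sub (update σ x (binder σ x φ)) φ)) ≡ renameBody σ (bind x (nameless φ))

nameless-sub σ (atom P xs) = cong (at P) (trans (sym (map-∘ free σ xs)) (map-∘ (renameName σ) free xs))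
nameless-sub σ ⊥'          = refl
nameless-sub σ (φ ⇒' ψ)    = cong₂ imp (nameless-sub σ φ) (nameless-sub σ ψ)
nameless-sub σ (φ ∧' ψ)    = cong₂ and (nameless-sub σ φ) (nameless-sub σ ψ)
nameless-sub σ (φ ⩒ ψ)     = cong₂ or (nameless-sub σ φ) (nameless-sub σ ψ)
nameless-sub σ (∀' x φ)    = cong all (nameless-sub-body σ x φ)
nameless-sub σ (∃' x φ)    = cong ex (nameless-sub-body σ x φ)

nameless-sub-body σ x φ = begin
  bind x′ (nameless (sub (update σ x x′) φ))   ≡⟨ cong (bind x′) (nameless-sub (update σ x x′) φ) ⟩
  bind x′ (rename (update σ x x′) (nameless φ)) ≡⟨ bind-rename σ x x′ (nameless φ) no-capture ⟩
  rename σ (bind x (nameless φ))                ≡⟨ mapNames-const (renameName σ) 0 1 _ ⟩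
  renameBody σ (bind x (nameless φ)) ∎
  where
  open ≡-Reasoning
  x′ = binder σ x φ
  no-capture : ∀ v → Occurs (free v) (nameless φ) → v ≢ x → σ v ≢ x′
  no-capture v o v≢x σv≡x′ = binder-avoids σ x φ (subst (_∈ map σ (fv (∀' x φ))) σv≡x′
    (∈-map⁺ σ (∈-filter⁺ (λ y → ¬? (y ≟ x)) (free-nameless⊆fv φ o) v≢x)))

rename-single≡inst∘bind : ∀ x z t → LocallyClosed t → rename (update id x z) t ≡ inst z (bind x t)
rename-single≡inst∘bind x z t closed = trans (mapNames-cong _ _ 0 t pointwise) (sym (mapNames-∘ _ _ 0 t))
  where
  pointwise : ∀ {l a} → OccursAt a 0 l t → renameName (update id x z) a ≡ instName z l (bindName x l a)
  pointwise {l} {bound k} o with k ≟ l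
  ... | yes refl = ⊥-elim (<-irrefl refl (closed o))
  ... | no  _    = refl
  pointwise {l} {free v} o with v ≟ x
  ... | no  _ = refl
  ... | yes _ with l ≟ l
  ...   | yes _   = refl
  ...   | no  l≢l = ⊥-elim (l≢l refl)

inst-rename : ∀ ρ z t → inst (ρ z) (rename ρ t) ≡ rename ρ (inst z t)
inst-rename ρ z t = mapNames-∘-cong _ _ _ _ 0 t pointwise
  where
  pointwise : ∀ {l a} → OccursAt a 0 l t → instName (ρ z) l (renameName ρ a) ≡ renameName ρ (instName z l a)
  pointwise {a = free v}  _ = refl
  pointwise {l} {bound k} _ with k ≟ l
  ... | yes _ = refl
  ... | no  _ = refl

nameless-[/] : ∀ x z φ → nameless (φ [ z / x ]) ≡ inst z (bind x (nameless φ))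
nameless-[/] x z φ =
  trans (nameless-sub (update id x z) φ) (rename-single≡inst∘bind x z (nameless φ) (nameless-locallyClosed φ))

rename-[/] : ∀ σ σ′ x z w φ → σ′ z ≡ w → (∀ v → Occurs (free v) (bind x (nameless φ)) → σ′ v ≡ σ v) →
  rename σ′ (nameless (φ [ z / x ])) ≡ inst w (renameBody σ (bind x (nameless φ)))
rename-[/] σ σ′ x z w φ σ′z≡w σ′≡σ = begin
  rename σ′ (nameless (φ [ z / x ]))            ≡⟨ cong (rename σ′) (nameless-[/] x z φ) ⟩
  rename σ′ (inst z (bind x (nameless φ)))      ≡⟨ sym (inst-rename σ′ z _) ⟩
  inst (σ′ z) (rename σ′ (bind x (nameless φ))) ≡⟨ cong₂ inst σ′z≡w (rename-cong σ′ σ _ σ′≡σ) ⟩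
  inst w (rename σ (bind x (nameless φ)))       ≡⟨ cong (inst w) (mapNames-const (renameName σ) 0 1 _) ⟩
  inst w (renameBody σ (bind x (nameless φ)))   ∎
  where open ≡-Reasoning

rename-instance : ∀ σ y x φ →
  rename σ (nameless (φ [ y / x ])) ≡ inst (σ y) (renameBody σ (bind x (nameless φ)))
rename-instance σ y x φ = rename-[/] σ σ x y (σ y) φ refl (λ _ _ → refl)

rename-eigen-instance : ∀ σ z w x φ → ¬ Occurs (free z) (bind x (nameless φ)) →
  rename (update σ z w) (nameless (φ [ z / x ])) ≡ inst w (renameBody σ (bind x (nameless φ)))
rename-eigen-instance σ z w x φ z∉φ =
  rename-[/] σ _ x z w φ (update-≡ σ z w) (λ v o → update-≢ σ w (λ { refl → z∉φ o }))

nameless-[/]-body : ∀ w → bind x (nameless φ) ≡ t → nameless (φ [ w / x ]) ≡ inst w t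
nameless-[/]-body {x = x} {φ = φ} w refl = nameless-[/] x w φ

size : Formula → ℕ
size (atom P xs) = 1
size ⊥'          = 1
size (φ ⇒' ψ)    = suc (size φ + size ψ)
size (φ ∧' ψ)    = suc (size φ + size ψ)
size (φ ⩒ ψ)     = suc (size φ + size ψ)
size (∀' x φ)    = suc (size φ)
size (∃' x φ)    = suc (size φ)

size-sub : ∀ σ φ → size (sub σ φ) ≡ size φ
size-sub σ (atom P xs) = refl
size-sub σ ⊥'          = refl
size-sub σ (φ ⇒' ψ)    = cong₂ (λ m n → suc (m + n)) (size-sub σ φ) (size-sub σ ψ)
size-sub σ (φ ∧' ψ)    = cong₂ (λ m n → suc (m + n)) (size-sub σ φ) (size-sub σ ψ)
size-sub σ (φ ⩒ ψ)     = cong₂ (λ m n → suc (m + n)) (size-sub σ φ) (size-sub σ ψ)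
size-sub σ (∀' x φ)    = cong suc (size-sub _ φ)
size-sub σ (∃' x φ)    = cong suc (size-sub _ φ)

-- Derivations with shapes

data Shape : Set where
  leaf        : Shape
  unary       : Shape → Shape
  binary      : Shape → Shape → Shape
  perPoint    : (ks : List ℕ) → ((k : ℕ) → k ∈ ks → Shape) → Shape
  perSublabel : (ks : List ℕ) → ((Y : Label) → elems Y ⊆ ks → Shape) → Shape

variable
  s s′ : Shape
  ks : List ℕ
  Γ Δ Γ′ Δ′ Γ″ Δ″ : List LFormula
  A B C : LFormula
  X Y : Label
  P : PredSym

data _≺_ : Shape → Shape → Set where
  unary       : s ≺ unary s
  binary₁     : s ≺ binary s s′
  binary₂     : s′ ≺ binary s s′
  perPoint    : ∀ {f} (p : k ∈ ks) → f k p ≺ perPoint ks f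
  perSublabel : ∀ {f} (Y : Label) (p : elems Y ⊆ ks) → f Y p ≺ perSublabel ks f

-- Sequents as sets: the principal formula of a rule is any member of the
-- sequent and stays in the premises, so contraction is built in.  The shape
-- index is the induction measure of cut elimination; `pad` lets a derivation
-- skip a rule while keeping its shape.
infix 2 _⊢[_]_
data _⊢[_]_ : List LFormula → Shape → List LFormula → Set where
  ax  : ∀ {xs} → (X ∶ atom P xs) ∈ Γ → (Y ∶ atom P xs) ∈ Δ → Y ⊆L X → Γ ⊢[ leaf ] Δ
  ⊥L  : (X ∶ ⊥') ∈ Γ → Γ ⊢[ leaf ] Δ
  atR : ∀ {xs f} → (X ∶ atom P xs) ∈ Δ →
        (∀ k (p : k ∈ elems X) → Γ ⊢[ f k p ] (singleton k ∶ atom P xs) ∷ Δ) →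
        Γ ⊢[ perPoint (elems X) f ] Δ
  ∧R  : (X ∶ φ ∧' ψ) ∈ Δ → Γ ⊢[ s ] (X ∶ φ) ∷ Δ → Γ ⊢[ s′ ] (X ∶ ψ) ∷ Δ → Γ ⊢[ binary s s′ ] Δ
  ∧L  : (X ∶ φ ∧' ψ) ∈ Γ → (X ∶ φ) ∷ (X ∶ ψ) ∷ Γ ⊢[ s ] Δ → Γ ⊢[ unary s ] Δ
  ⩒R  : (X ∶ φ ⩒ ψ) ∈ Δ → Γ ⊢[ s ] (X ∶ φ) ∷ (X ∶ ψ) ∷ Δ → Γ ⊢[ unary s ] Δ
  ⩒L  : (X ∶ φ ⩒ ψ) ∈ Γ → (X ∶ φ) ∷ Γ ⊢[ s ] Δ → (X ∶ ψ) ∷ Γ ⊢[ s′ ] Δ → Γ ⊢[ binary s s′ ] Δ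
  →R  : ∀ {f} → (X ∶ φ ⇒' ψ) ∈ Δ →
        (∀ Y (p : Y ⊆L X) → (Y ∶ φ) ∷ Γ ⊢[ f Y p ] (Y ∶ ψ) ∷ Δ) →
        Γ ⊢[ perSublabel (elems X) f ] Δ
  →L  : (X ∶ φ ⇒' ψ) ∈ Γ → Y ⊆L X → Γ ⊢[ s ] (Y ∶ φ) ∷ Δ → (Y ∶ ψ) ∷ Γ ⊢[ s′ ] Δ → Γ ⊢[ binary s s′ ] Δ
  ∀R  : (X ∶ ∀' x φ) ∈ Δ → z ∉ occ Γ Δ → Γ ⊢[ s ] (X ∶ φ [ z / x ]) ∷ Δ → Γ ⊢[ unary s ] Δ
  ∀L  : (X ∶ ∀' x φ) ∈ Γ → (X ∶ φ [ y / x ]) ∷ Γ ⊢[ s ] Δ → Γ ⊢[ unary s ] Δ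
  ∃R  : (X ∶ ∃' x φ) ∈ Δ → Γ ⊢[ s ] (X ∶ φ [ y / x ]) ∷ Δ → Γ ⊢[ unary s ] Δ
  ∃L  : (X ∶ ∃' x φ) ∈ Γ → z ∉ occ Γ Δ → (X ∶ φ [ z / x ]) ∷ Γ ⊢[ s ] Δ → Γ ⊢[ unary s ] Δ
  pad : s′ ≺ s → Γ ⊢[ s′ ] Δ → Γ ⊢[ s ] Δ

infix 2 _⊩_
_⊩_ : List LFormula → List LFormula → Set
Γ ⊩ Δ = ∃ λ s → Γ ⊢[ s ] Δ

atR-≡ : ∀ {xs f} → elems X ≡ ks → (X ∶ atom P xs) ∈ Δ →
  (∀ k (p : k ∈ ks) → Γ ⊢[ f k p ] (singleton k ∶ atom P xs) ∷ Δ) → Γ ⊢[ perPoint ks f ] Δ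
atR-≡ refl m prem = atR m prem

→R-≡ : ∀ {f} → elems X ≡ ks → (X ∶ φ ⇒' ψ) ∈ Δ →
  (∀ Y (p : elems Y ⊆ ks) → (Y ∶ φ) ∷ Γ ⊢[ f Y p ] (Y ∶ ψ) ∷ Δ) → Γ ⊢[ perSublabel ks f ] Δ
→R-≡ refl m prem = →R m prem

⊆-drop² : Γ ⊆ A ∷ B ∷ Γ
⊆-drop² m = there (there m)

⊆-swap : A ∷ B ∷ Γ ⊆ B ∷ A ∷ Γ
⊆-swap (here refl)         = there (here refl)
⊆-swap (there (here refl)) = here refl
⊆-swap (there (there m))   = there (there m)

⊆-rotate : A ∷ B ∷ C ∷ Γ ⊆ C ∷ A ∷ B ∷ Γ
⊆-rotate (here refl)                 = there (here refl)
⊆-rotate (there (here refl))         = there (there (here refl))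
⊆-rotate (there (there (here refl))) = here refl
⊆-rotate (there (there (there m)))   = there (there (there m))

-- Covers and simulation

data NamelessView : Formula → Nameless → Set where
  is-atom : ∀ {xs ns} → Vec.map free xs ≡ ns → NamelessView (atom P xs) (at P ns)
  is-⊥    : NamelessView ⊥' bot
  is-⇒    : nameless φ ≡ t → nameless ψ ≡ u → NamelessView (φ ⇒' ψ) (imp t u)
  is-∧    : nameless φ ≡ t → nameless ψ ≡ u → NamelessView (φ ∧' ψ) (and t u)
  is-⩒    : nameless φ ≡ t → nameless ψ ≡ u → NamelessView (φ ⩒ ψ) (or t u)
  is-∀    : bind x (nameless φ) ≡ t → NamelessView (∀' x φ) (all t)
  is-∃    : bind x (nameless φ) ≡ t → NamelessView (∃' x φ) (ex t)

namelessView : ∀ χ → nameless χ ≡ t → NamelessView χ t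
namelessView (atom P xs) refl = is-atom {xs = xs} refl
namelessView ⊥'          refl = is-⊥
namelessView (φ ⇒' ψ)    refl = is-⇒ refl refl
namelessView (φ ∧' ψ)    refl = is-∧ refl refl
namelessView (φ ⩒ ψ)     refl = is-⩒ refl refl
namelessView (∀' x φ)    refl = is-∀ refl
namelessView (∃' x φ)    refl = is-∃ refl

-- ks : t is covered on the left by Γ if it is α-equivalent to a member of Γ,
-- or if what one application of its left rule adds is covered: one branch of a
-- ⩒, one instance of an ∃.  RightCover is the dual notion: one conjunct, one
-- instance of a ∀, one sublabel of an →, one point of an atom.  Labels are
-- compared through their elements, since a Label also carries proofs.
data LeftCover (Γ : List LFormula) : List ℕ → Nameless → Set where
  has : A ∈ Γ → elems (lab A) ≡ ks → nameless (form A) ≡ t → LeftCover Γ ks t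
  and : LeftCover Γ ks t → LeftCover Γ ks u → LeftCover Γ ks (and t u)
  or₁ : LeftCover Γ ks t → LeftCover Γ ks (or t u)
  or₂ : LeftCover Γ ks u → LeftCover Γ ks (or t u)
  ex  : ∀ w → LeftCover Γ ks (inst w t) → LeftCover Γ ks (ex t)

data RightCover (Γ Δ : List LFormula) : List ℕ → Nameless → Set where
  has  : A ∈ Δ → elems (lab A) ≡ ks → nameless (form A) ≡ t → RightCover Γ Δ ks t
  and₁ : RightCover Γ Δ ks t → RightCover Γ Δ ks (and t u)
  and₂ : RightCover Γ Δ ks u → RightCover Γ Δ ks (and t u)
  or   : RightCover Γ Δ ks t → RightCover Γ Δ ks u → RightCover Γ Δ ks (or t u)
  imp  : ∀ Y → elems Y ⊆ ks → LeftCover Γ (elems Y) t → RightCover Γ Δ (elems Y) u → RightCover Γ Δ ks (imp t u)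
  all  : ∀ w → RightCover Γ Δ ks (inst w t) → RightCover Γ Δ ks (all t)
  at   : ∀ {ns} → k ∈ ks → RightCover Γ Δ (k ∷ []) (at P ns) → RightCover Γ Δ ks (at P ns)

leftCover-mono : Γ ⊆ Γ′ → LeftCover Γ ks t → LeftCover Γ′ ks t
leftCover-mono Γ⊆ (has m e n) = has (Γ⊆ m) e n
leftCover-mono Γ⊆ (and c c′)  = and (leftCover-mono Γ⊆ c) (leftCover-mono Γ⊆ c′)
leftCover-mono Γ⊆ (or₁ c)     = or₁ (leftCover-mono Γ⊆ c)
leftCover-mono Γ⊆ (or₂ c)     = or₂ (leftCover-mono Γ⊆ c)
leftCover-mono Γ⊆ (ex w c)    = ex w (leftCover-mono Γ⊆ c)

rightCover-mono : Γ ⊆ Γ′ → Δ ⊆ Δ′ → RightCover Γ Δ ks t → RightCover Γ′ Δ′ ks t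
rightCover-mono Γ⊆ Δ⊆ (has m e n)     = has (Δ⊆ m) e n
rightCover-mono Γ⊆ Δ⊆ (and₁ c)        = and₁ (rightCover-mono Γ⊆ Δ⊆ c)
rightCover-mono Γ⊆ Δ⊆ (and₂ c)        = and₂ (rightCover-mono Γ⊆ Δ⊆ c)
rightCover-mono Γ⊆ Δ⊆ (or c c′)       = or (rightCover-mono Γ⊆ Δ⊆ c) (rightCover-mono Γ⊆ Δ⊆ c′)
rightCover-mono Γ⊆ Δ⊆ (imp Y Y⊆ c c′) = imp Y Y⊆ (leftCover-mono Γ⊆ c) (rightCover-mono Γ⊆ Δ⊆ c′)
rightCover-mono Γ⊆ Δ⊆ (all w c)       = all w (rightCover-mono Γ⊆ Δ⊆ c)
rightCover-mono Γ⊆ Δ⊆ (at k∈ c)       = at k∈ (rightCover-mono Γ⊆ Δ⊆ c)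

leftCover-at : ∀ {ns} → LeftCover Γ ks (at P ns) →
  ∃₂ λ X xs → (X ∶ atom P xs) ∈ Γ × elems X ≡ ks × Vec.map free xs ≡ ns
leftCover-at (has {A = X ∶ χ} m e n) with namelessView χ n
... | is-atom e′ = X , _ , m , e , e′

rightCover-at : ∀ {ns} → RightCover Γ Δ ks (at P ns) →
  ∃₂ λ Y xs → (Y ∶ atom P xs) ∈ Δ × elems Y ⊆ ks × Vec.map free xs ≡ ns
rightCover-at (has {A = Y ∶ χ} m refl n) with namelessView χ n
... | is-atom e′ = Y , _ , m , id , e′
rightCover-at (at k∈ c) with rightCover-at c
... | Y , xs , m , Y⊆k , e = Y , xs , m , (λ k′∈ → case Y⊆k k′∈ of λ { (here refl) → k∈ }) , e

record Covers (σ : ℕ → ℕ) (Γ Δ Γ′ Δ′ : List LFormula) : Set where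
  field
    left  : ∀ {A} → A ∈ Γ → LeftCover Γ′ (elems (lab A)) (rename σ (nameless (form A)))
    right : ∀ {A} → A ∈ Δ → RightCover Γ′ Δ′ (elems (lab A)) (rename σ (nameless (form A)))
open Covers

idCoverˡ : A ∈ Γ → LeftCover Γ (elems (lab A)) (rename id (nameless (form A)))
idCoverˡ m = has m refl (sym (rename-id _))

idCoverʳ : A ∈ Δ → RightCover Γ Δ (elems (lab A)) (rename id (nameless (form A)))
idCoverʳ m = has m refl (sym (rename-id _))

covers-id : Γ ⊆ Γ′ → Δ ⊆ Δ′ → Covers id Γ Δ Γ′ Δ′
covers-id Γ⊆ Δ⊆ = record { left = λ m → idCoverˡ (Γ⊆ m) ; right = λ m → idCoverʳ (Δ⊆ m) }

covers-antimono : Γ ⊆ Γ″ → Δ ⊆ Δ″ → Covers σ Γ″ Δ″ Γ′ Δ′ → Covers σ Γ Δ Γ′ Δ′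
covers-antimono Γ⊆ Δ⊆ cv = record { left = λ m → left cv (Γ⊆ m) ; right = λ m → right cv (Δ⊆ m) }

covers-mono : Γ′ ⊆ Γ″ → Δ′ ⊆ Δ″ → Covers σ Γ Δ Γ′ Δ′ → Covers σ Γ Δ Γ″ Δ″
covers-mono Γ⊆ Δ⊆ cv = record
  { left  = λ m → leftCover-mono Γ⊆ (left cv m)
  ; right = λ m → rightCover-mono Γ⊆ Δ⊆ (right cv m)
  }

covers-update : ∀ w → z ∉ occ Γ Δ → Covers σ Γ Δ Γ′ Δ′ → Covers (update σ z w) Γ Δ Γ′ Δ′
covers-update {z = z} {Γ = Γ} {Δ = Δ} {σ = σ} w z∉ cv = record
  { left  = λ m → subst (LeftCover _ _) (sym (unchanged (∈-++⁺ˡ m))) (left cv m)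
  ; right = λ m → subst (RightCover _ _ _) (sym (unchanged (∈-++⁺ʳ Γ m))) (right cv m)
  }
  where
  unchanged : ∀ {A} → A ∈ Γ ++ Δ → rename (update σ z w) (nameless (form A)) ≡ rename σ (nameless (form A))
  unchanged A∈ = rename-update-fresh σ z w _ (fresh-member Γ Δ z∉ A∈)

infixr 5 _◁ˡ_ _◁ʳ_

_◁ˡ_ : LeftCover Γ′ (elems X) (rename σ (nameless φ)) → Covers σ Γ Δ Γ′ Δ′ → Covers σ ((X ∶ φ) ∷ Γ) Δ Γ′ Δ′
c ◁ˡ cv = record { left = λ { (here refl) → c ; (there m) → left cv m } ; right = right cv }

_◁ʳ_ : RightCover Γ′ Δ′ (elems X) (rename σ (nameless φ)) → Covers σ Γ Δ Γ′ Δ′ → Covers σ Γ ((X ∶ φ) ∷ Δ) Γ′ Δ′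
c ◁ʳ cv = record { left = left cv ; right = λ { (here refl) → c ; (there m) → right cv m } }

extendˡ : ∀ {X′ φ′} → elems X′ ≡ elems X → nameless φ′ ≡ rename σ (nameless φ) →
  Covers σ Γ Δ Γ′ Δ′ → Covers σ ((X ∶ φ) ∷ Γ) Δ ((X′ ∶ φ′) ∷ Γ′) Δ′
extendˡ e n cv = has (here refl) e n ◁ˡ covers-mono there ⊆-refl cv

extendʳ : ∀ {X′ φ′} → elems X′ ≡ elems X → nameless φ′ ≡ rename σ (nameless φ) →
  Covers σ Γ Δ Γ′ Δ′ → Covers σ Γ ((X ∶ φ) ∷ Δ) Γ′ ((X′ ∶ φ′) ∷ Δ′)
extendʳ e n cv = has (here refl) e n ◁ʳ covers-mono ⊆-refl there cv

-- Every rule application is replayed on the covering formulas, or skipped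
-- (via `pad`) when the cover already provides its premise.
simulate : Γ ⊢[ s ] Δ → ∀ σ → Covers σ Γ Δ Γ′ Δ′ → Γ′ ⊢[ s ] Δ′
simulate (ax p q Y⊆X) σ cv with leftCover-at (left cv p) | rightCover-at (right cv q)
... | X′ , xs , m , e , n | Y′ , ys , m′ , Y′⊆Y , n′ =
  ax m (subst (λ zs → (Y′ ∶ atom _ zs) ∈ _) (map-free-injective (trans n′ (sym n))) m′)
       (λ k∈ → subst (_ ∈_) (sym e) (Y⊆X (Y′⊆Y k∈)))
simulate (⊥L p) σ cv with left cv p
... | has {A = _ ∶ χ} m _ n with namelessView χ n
...   | is-⊥ = ⊥L m
simulate (atR p prem) σ cv with right cv p
... | at k∈ c = pad (perPoint k∈) (simulate (prem _ k∈) σ (c ◁ʳ cv))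
... | has {A = _ ∶ χ} m e n with namelessView χ n
...   | is-atom n′ = atR-≡ e m (λ k k∈ → simulate (prem k k∈) σ (extendʳ refl (cong (at _) n′) cv))
simulate (∧R p d₁ d₂) σ cv with right cv p
... | and₁ c = pad binary₁ (simulate d₁ σ (c ◁ʳ cv))
... | and₂ c = pad binary₂ (simulate d₂ σ (c ◁ʳ cv))
... | has {A = _ ∶ χ} m e n with namelessView χ n
...   | is-∧ n₁ n₂ = ∧R m (simulate d₁ σ (extendʳ e n₁ cv)) (simulate d₂ σ (extendʳ e n₂ cv))
simulate (∧L p d) σ cv with left cv p
... | and c₁ c₂ = pad unary (simulate d σ (c₁ ◁ˡ c₂ ◁ˡ cv))
... | has {A = _ ∶ χ} m e n with namelessView χ n
...   | is-∧ n₁ n₂ = ∧L m (simulate d σ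
        (has (here refl) e n₁ ◁ˡ has (there (here refl)) e n₂ ◁ˡ covers-mono ⊆-drop² ⊆-refl cv))
simulate (⩒R p d) σ cv with right cv p
... | or c₁ c₂ = pad unary (simulate d σ (c₁ ◁ʳ c₂ ◁ʳ cv))
... | has {A = _ ∶ χ} m e n with namelessView χ n
...   | is-⩒ n₁ n₂ = ⩒R m (simulate d σ
        (has (here refl) e n₁ ◁ʳ has (there (here refl)) e n₂ ◁ʳ covers-mono ⊆-refl ⊆-drop² cv))
simulate (⩒L p d₁ d₂) σ cv with left cv p
... | or₁ c = pad binary₁ (simulate d₁ σ (c ◁ˡ cv))
... | or₂ c = pad binary₂ (simulate d₂ σ (c ◁ˡ cv))
... | has {A = _ ∶ χ} m e n with namelessView χ n
...   | is-⩒ n₁ n₂ = ⩒L m (simulate d₁ σ (extendˡ e n₁ cv)) (simulate d₂ σ (extendˡ e n₂ cv))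
simulate (→R p prem) σ cv with right cv p
... | imp Y Y⊆ c₁ c₂ = pad (perSublabel Y Y⊆) (simulate (prem Y Y⊆) σ (c₁ ◁ˡ c₂ ◁ʳ cv))
... | has {A = _ ∶ χ} m e n with namelessView χ n
...   | is-⇒ n₁ n₂ = →R-≡ e m (λ Y Y⊆ → simulate (prem Y Y⊆) σ (extendˡ refl n₁ (extendʳ refl n₂ cv)))
simulate (→L {Y = Y} p Y⊆X d₁ d₂) σ cv with left cv p
... | has {A = _ ∶ χ} m e n with namelessView χ n
...   | is-⇒ n₁ n₂ = →L {Y = Y} m (λ k∈ → subst (_ ∈_) (sym e) (Y⊆X k∈))
        (simulate d₁ σ (extendʳ refl n₁ cv)) (simulate d₂ σ (extendˡ refl n₂ cv))
simulate {Γ = Γ} {Δ = Δ} {Γ′ = Γ′} {Δ′ = Δ′} (∀R {x = x} {φ = φ} {z = z} p z∉ d) σ cv with right cv p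
... | all w c = pad unary (simulate d (update σ z w) (c′ ◁ʳ covers-update w z∉ cv))
  where c′ = subst (RightCover Γ′ Δ′ _) (sym (rename-eigen-instance σ z w x φ (fresh-∀-body Γ Δ z∉ p))) c
... | has {A = _ ∶ χ} m e n with namelessView χ n
...   | is-∀ n′ = ∀R m (fresh∉ (occ Γ′ Δ′)) (simulate d (update σ z z′) (extendʳ e n″ (covers-update z′ z∉ cv)))
  where
  z′ = fresh (occ Γ′ Δ′)
  n″ = trans (nameless-[/]-body z′ n′) (sym (rename-eigen-instance σ z z′ x φ (fresh-∀-body Γ Δ z∉ p)))
simulate (∀L {x = x} {φ = φ} {y = y} p d) σ cv with left cv p
... | has {A = _ ∶ χ} m e n with namelessView χ n
...   | is-∀ n′ = ∀L m (simulate d σ (extendˡ e n″ cv))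
  where n″ = trans (nameless-[/]-body (σ y) n′) (sym (rename-instance σ y x φ))
simulate (∃R {x = x} {φ = φ} {y = y} p d) σ cv with right cv p
... | has {A = _ ∶ χ} m e n with namelessView χ n
...   | is-∃ n′ = ∃R m (simulate d σ (extendʳ e n″ cv))
  where n″ = trans (nameless-[/]-body (σ y) n′) (sym (rename-instance σ y x φ))
simulate {Γ = Γ} {Δ = Δ} {Γ′ = Γ′} {Δ′ = Δ′} (∃L {x = x} {φ = φ} {z = z} p z∉ d) σ cv with left cv p
... | ex w c = pad unary (simulate d (update σ z w) (c′ ◁ˡ covers-update w z∉ cv))
  where c′ = subst (LeftCover Γ′ _) (sym (rename-eigen-instance σ z w x φ (fresh-∃-body Γ Δ z∉ p))) c
... | has {A = _ ∶ χ} m e n with namelessView χ n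
...   | is-∃ n′ = ∃L m (fresh∉ (occ Γ′ Δ′)) (simulate d (update σ z z′) (extendˡ e n″ (covers-update z′ z∉ cv)))
  where
  z′ = fresh (occ Γ′ Δ′)
  n″ = trans (nameless-[/]-body z′ n′) (sym (rename-eigen-instance σ z z′ x φ (fresh-∃-body Γ Δ z∉ p)))
simulate (pad c d) σ cv = pad c (simulate d σ cv)

weaken : Γ ⊆ Γ′ → Δ ⊆ Δ′ → Γ ⊢[ s ] Δ → Γ′ ⊢[ s ] Δ′
weaken Γ⊆ Δ⊆ d = simulate d id (covers-id Γ⊆ Δ⊆)

nameless-instance : ∀ y x φ → nameless (φ [ y / x ]) ≡ inst y (renameBody id (bind x (nameless φ)))
nameless-instance y x φ = trans (sym (rename-id _)) (rename-instance id y x φ)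

rename-eigenvariable : ∀ x z y φ → ¬ Occurs (free z) (bind x (nameless φ)) →
  nameless (φ [ y / x ]) ≡ rename (update id z y) (nameless (φ [ z / x ]))
rename-eigenvariable x z y φ z∉φ = trans (nameless-instance y x φ) (sym (rename-eigen-instance id z y x φ z∉φ))

eigenvariable-substʳ : z ∉ occ Γ ((X ∶ ∀' x φ) ∷ Δ) →
  Γ ⊢[ s ] (X ∶ φ [ z / x ]) ∷ Δ → Γ ⊢[ s ] (X ∶ φ [ y / x ]) ∷ Δ
eigenvariable-substʳ {z = z} {Γ = Γ} {x = x} {φ = φ} {Δ = Δ} {y = y} z∉ d =
  simulate d (update id z y)
    (has (here refl) refl (rename-eigenvariable x z y φ (fresh-∀-body Γ _ z∉ (here refl))) ◁ʳ
     covers-update y (∉occ-mono Γ Δ ⊆-refl there z∉) (covers-id ⊆-refl there))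

eigenvariable-substˡ : z ∉ occ ((X ∶ ∃' x φ) ∷ Γ) Δ →
  (X ∶ φ [ z / x ]) ∷ Γ ⊢[ s ] Δ → (X ∶ φ [ y / x ]) ∷ Γ ⊢[ s ] Δ
eigenvariable-substˡ {z = z} {X = X} {x = x} {φ = φ} {Γ = Γ} {Δ = Δ} {y = y} z∉ d =
  simulate d (update id z y)
    (has (here refl) refl (rename-eigenvariable x z y φ (fresh-∃-body ((X ∶ ∃' x φ) ∷ Γ) Δ z∉ (here refl))) ◁ˡ
     covers-update y (∉occ-mono Γ Δ (there {x = X ∶ ∃' x φ}) ⊆-refl z∉) (covers-id there ⊆-refl))

-- Cut elimination

weakenˡ : Γ ⊢[ s ] Δ → A ∷ Γ ⊢[ s ] Δ
weakenˡ = weaken there ⊆-refl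

weakenʳ : Γ ⊢[ s ] Δ → Γ ⊢[ s ] A ∷ Δ
weakenʳ = weaken ⊆-refl there

exchangeˡ : A ∷ B ∷ Γ ⊢[ s ] Δ → B ∷ A ∷ Γ ⊢[ s ] Δ
exchangeˡ = weaken ⊆-swap ⊆-refl

exchangeʳ : Γ ⊢[ s ] A ∷ B ∷ Δ → Γ ⊢[ s ] B ∷ A ∷ Δ
exchangeʳ = weaken ⊆-refl ⊆-swap

atR⊩ : ∀ {xs} → (X ∶ atom P xs) ∈ Δ →
  (∀ k → k ∈ elems X → Γ ⊩ (singleton k ∶ atom P xs) ∷ Δ) → Γ ⊩ Δ
atR⊩ p prem = -, atR p (λ k k∈ → proj₂ (prem k k∈))

→R⊩ : (X ∶ φ ⇒' ψ) ∈ Δ → (∀ Y → Y ⊆L X → (Y ∶ φ) ∷ Γ ⊩ (Y ∶ ψ) ∷ Δ) → Γ ⊩ Δ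
→R⊩ p prem = -, →R p (λ Y Y⊆ → proj₂ (prem Y Y⊆))

data RightIntro : LFormula → List LFormula → List LFormula → Shape → Set where
  ax  : ∀ {X₀ xs} → (X₀ ∶ atom P xs) ∈ Γ → X ⊆L X₀ → RightIntro (X ∶ atom P xs) Γ Δ leaf
  atR : ∀ {xs f} →
        (∀ k (p : k ∈ elems X) → Γ ⊢[ f k p ] (singleton k ∶ atom P xs) ∷ (X ∶ atom P xs) ∷ Δ) →
        RightIntro (X ∶ atom P xs) Γ Δ (perPoint (elems X) f)
  ∧R  : Γ ⊢[ s ] (X ∶ φ) ∷ (X ∶ φ ∧' ψ) ∷ Δ → Γ ⊢[ s′ ] (X ∶ ψ) ∷ (X ∶ φ ∧' ψ) ∷ Δ →
        RightIntro (X ∶ φ ∧' ψ) Γ Δ (binary s s′)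
  ⩒R  : Γ ⊢[ s ] (X ∶ φ) ∷ (X ∶ ψ) ∷ (X ∶ φ ⩒ ψ) ∷ Δ →
        RightIntro (X ∶ φ ⩒ ψ) Γ Δ (unary s)
  →R  : ∀ {f} → (∀ Y (p : Y ⊆L X) → (Y ∶ φ) ∷ Γ ⊢[ f Y p ] (Y ∶ ψ) ∷ (X ∶ φ ⇒' ψ) ∷ Δ) →
        RightIntro (X ∶ φ ⇒' ψ) Γ Δ (perSublabel (elems X) f)
  ∀R  : z ∉ occ Γ ((X ∶ ∀' x φ) ∷ Δ) → Γ ⊢[ s ] (X ∶ φ [ z / x ]) ∷ (X ∶ ∀' x φ) ∷ Δ →
        RightIntro (X ∶ ∀' x φ) Γ Δ (unary s)
  ∃R  : Γ ⊢[ s ] (X ∶ φ [ y / x ]) ∷ (X ∶ ∃' x φ) ∷ Δ →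
        RightIntro (X ∶ ∃' x φ) Γ Δ (unary s)

data LeftIntro : LFormula → List LFormula → List LFormula → Shape → Set where
  ax : ∀ {xs} → (Y ∶ atom P xs) ∈ Δ → Y ⊆L X → LeftIntro (X ∶ atom P xs) Γ Δ leaf
  ⊥L : LeftIntro (X ∶ ⊥') Γ Δ leaf
  ∧L : (X ∶ φ) ∷ (X ∶ ψ) ∷ (X ∶ φ ∧' ψ) ∷ Γ ⊢[ s ] Δ →
       LeftIntro (X ∶ φ ∧' ψ) Γ Δ (unary s)
  ⩒L : (X ∶ φ) ∷ (X ∶ φ ⩒ ψ) ∷ Γ ⊢[ s ] Δ → (X ∶ ψ) ∷ (X ∶ φ ⩒ ψ) ∷ Γ ⊢[ s′ ] Δ →
       LeftIntro (X ∶ φ ⩒ ψ) Γ Δ (binary s s′)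
  →L : Y ⊆L X → (X ∶ φ ⇒' ψ) ∷ Γ ⊢[ s ] (Y ∶ φ) ∷ Δ → (Y ∶ ψ) ∷ (X ∶ φ ⇒' ψ) ∷ Γ ⊢[ s′ ] Δ →
       LeftIntro (X ∶ φ ⇒' ψ) Γ Δ (binary s s′)
  ∀L : (X ∶ φ [ y / x ]) ∷ (X ∶ ∀' x φ) ∷ Γ ⊢[ s ] Δ →
       LeftIntro (X ∶ ∀' x φ) Γ Δ (unary s)
  ∃L : z ∉ occ ((X ∶ ∃' x φ) ∷ Γ) Δ → (X ∶ φ [ z / x ]) ∷ (X ∶ ∃' x φ) ∷ Γ ⊢[ s ] Δ →
       LeftIntro (X ∶ ∃' x φ) Γ Δ (unary s)

rightIntro-weaken : Γ ⊆ Γ′ → Δ ⊆ Δ′ → RightIntro A Γ Δ s → RightIntro A Γ′ Δ′ s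
rightIntro-weaken Γ⊆ Δ⊆ (ax p X⊆)  = ax (Γ⊆ p) X⊆
rightIntro-weaken Γ⊆ Δ⊆ (atR prem) = atR (λ k p → weaken Γ⊆ (∷⁺ʳ _ (∷⁺ʳ _ Δ⊆)) (prem k p))
rightIntro-weaken Γ⊆ Δ⊆ (∧R d₁ d₂) = ∧R (weaken Γ⊆ (∷⁺ʳ _ (∷⁺ʳ _ Δ⊆)) d₁) (weaken Γ⊆ (∷⁺ʳ _ (∷⁺ʳ _ Δ⊆)) d₂)
rightIntro-weaken Γ⊆ Δ⊆ (⩒R d)     = ⩒R (weaken Γ⊆ (∷⁺ʳ _ (∷⁺ʳ _ (∷⁺ʳ _ Δ⊆))) d)
rightIntro-weaken Γ⊆ Δ⊆ (→R prem)  = →R (λ Y p → weaken (∷⁺ʳ _ Γ⊆) (∷⁺ʳ _ (∷⁺ʳ _ Δ⊆)) (prem Y p))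
rightIntro-weaken Γ⊆ Δ⊆ (∃R d)     = ∃R (weaken Γ⊆ (∷⁺ʳ _ (∷⁺ʳ _ Δ⊆)) d)
rightIntro-weaken {Γ = Γ} {Γ′ = Γ′} {Δ′ = Δ′} Γ⊆ Δ⊆ (∀R {X = X} {x = x} {φ = φ} {Δ = Δ} z∉ d) =
  ∀R (fresh∉ (occ Γ′ ((X ∶ ∀' x φ) ∷ Δ′))) (weaken Γ⊆ (∷⁺ʳ _ (∷⁺ʳ _ Δ⊆)) (eigenvariable-substʳ z∉′ d))
  where z∉′ = ∉occ-mono Γ (_ ∷ _ ∷ Δ) ⊆-refl (∈-∷⁺ʳ (here refl) ⊆-refl) z∉

size-[/] : ∀ φ y x → size (φ [ y / x ]) ≡ size φ
size-[/] φ y x = size-sub (update id x y) φ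

cut            : ∀ m → size (form A) ≤ m → Γ ⊢[ s ] A ∷ Δ → A ∷ Γ ⊢[ s′ ] Δ → Γ ⊩ Δ
cut-rightIntro : ∀ m → size (form A) ≤ m → RightIntro A Γ Δ s → A ∷ Γ ⊢[ s′ ] Δ → Γ ⊩ Δ
cut-principal  : ∀ m → size (form A) ≤ m →
  RightIntro A Γ Δ s → A ∷ Γ ⊢[ s′ ] Δ → LeftIntro A Γ Δ s′ → Γ ⊩ Δ

cut m b (ax p (here refl) Y⊆X) e = cut-rightIntro m b (ax p Y⊆X) e
cut m b (ax p (there q) Y⊆X)   e = -, ax p q Y⊆X
cut m b (⊥L p)                 e = -, ⊥L p
cut m b (atR (here refl) prem) e = cut-rightIntro m b (atR prem) e
cut m b (atR (there q) prem)   e = atR⊩ q (λ k k∈ → cut m b (exchangeʳ (prem k k∈)) (weakenʳ e))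
cut m b (∧R (here refl) d₁ d₂) e = cut-rightIntro m b (∧R d₁ d₂) e
cut m b (∧R (there q) d₁ d₂)   e =
  -, ∧R q (proj₂ (cut m b (exchangeʳ d₁) (weakenʳ e))) (proj₂ (cut m b (exchangeʳ d₂) (weakenʳ e)))
cut m b (∧L p d)               e = -, ∧L p (proj₂ (cut m b d (weaken (∷⁺ʳ _ ⊆-drop²) ⊆-refl e)))
cut m b (⩒R (here refl) d)     e = cut-rightIntro m b (⩒R d) e
cut m b (⩒R (there q) d)       e = -, ⩒R q (proj₂ (cut m b (weaken ⊆-refl ⊆-rotate d) (weakenʳ (weakenʳ e))))
cut m b (⩒L p d₁ d₂)           e =
  -, ⩒L p (proj₂ (cut m b d₁ (exchangeˡ (weakenˡ e)))) (proj₂ (cut m b d₂ (exchangeˡ (weakenˡ e))))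
cut m b (→R (here refl) prem)  e = cut-rightIntro m b (→R prem) e
cut m b (→R (there q) prem)    e =
  →R⊩ q (λ Y Y⊆ → cut m b (exchangeʳ (prem Y Y⊆)) (weakenʳ (exchangeˡ (weakenˡ e))))
cut m b (→L p Y⊆X d₁ d₂)       e =
  -, →L p Y⊆X (proj₂ (cut m b (exchangeʳ d₁) (weakenʳ e))) (proj₂ (cut m b d₂ (exchangeˡ (weakenˡ e))))
cut m b (∀R (here refl) z∉ d)  e = cut-rightIntro m b (∀R z∉ d) e
cut {Γ = Γ} {Δ = Δ} m b (∀R (there q) z∉ d) e =
  -, ∀R q (∉occ-mono Γ Δ ⊆-refl there z∉) (proj₂ (cut m b (exchangeʳ d) (weakenʳ e)))
cut m b (∀L p d)               e = -, ∀L p (proj₂ (cut m b d (exchangeˡ (weakenˡ e))))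
cut m b (∃R (here refl) d)     e = cut-rightIntro m b (∃R d) e
cut m b (∃R (there q) d)       e = -, ∃R q (proj₂ (cut m b (exchangeʳ d) (weakenʳ e)))
cut {Γ = Γ} {Δ = Δ} m b (∃L p z∉ d) e =
  -, ∃L p (∉occ-mono Γ Δ ⊆-refl there z∉) (proj₂ (cut m b d (exchangeˡ (weakenˡ e))))
cut m b (pad unary d)             e = cut m b d e
cut m b (pad binary₁ d)           e = cut m b d e
cut m b (pad binary₂ d)           e = cut m b d e
cut m b (pad (perPoint _) d)      e = cut m b d e
cut m b (pad (perSublabel _ _) d) e = cut m b d e

cut-rightIntro m b rp (ax (here refl) q Y⊆X) = cut-principal m b rp (ax (here refl) q Y⊆X) (ax q Y⊆X)
cut-rightIntro m b rp (ax (there p) q Y⊆X)   = -, ax p q Y⊆X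
cut-rightIntro m b rp (⊥L (here refl))       = cut-principal m b rp (⊥L (here refl)) ⊥L
cut-rightIntro m b rp (⊥L (there p))         = -, ⊥L p
cut-rightIntro m b rp (atR q prem)           =
  atR⊩ q (λ k k∈ → cut-rightIntro m b (rightIntro-weaken ⊆-refl there rp) (prem k k∈))
cut-rightIntro m b rp (∧R q e₁ e₂)           =
  -, ∧R q (proj₂ (cut-rightIntro m b (rightIntro-weaken ⊆-refl there rp) e₁))
          (proj₂ (cut-rightIntro m b (rightIntro-weaken ⊆-refl there rp) e₂))
cut-rightIntro m b rp (∧L (here refl) e₁)    = cut-principal m b rp (∧L (here refl) e₁) (∧L e₁)
cut-rightIntro m b rp (∧L (there p) e₁)      =
  -, ∧L p (proj₂ (cut-rightIntro m b (rightIntro-weaken ⊆-drop² ⊆-refl rp) (weaken ⊆-rotate ⊆-refl e₁)))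
cut-rightIntro m b rp (⩒R q e₁)              =
  -, ⩒R q (proj₂ (cut-rightIntro m b (rightIntro-weaken ⊆-refl ⊆-drop² rp) e₁))
cut-rightIntro m b rp (⩒L (here refl) e₁ e₂) = cut-principal m b rp (⩒L (here refl) e₁ e₂) (⩒L e₁ e₂)
cut-rightIntro m b rp (⩒L (there p) e₁ e₂)   =
  -, ⩒L p (proj₂ (cut-rightIntro m b (rightIntro-weaken there ⊆-refl rp) (exchangeˡ e₁)))
          (proj₂ (cut-rightIntro m b (rightIntro-weaken there ⊆-refl rp) (exchangeˡ e₂)))
cut-rightIntro m b rp (→R q prem)            =
  →R⊩ q (λ Y Y⊆ → cut-rightIntro m b (rightIntro-weaken there there rp) (exchangeˡ (prem Y Y⊆)))
cut-rightIntro m b rp (→L (here refl) Y⊆X e₁ e₂) =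
  cut-principal m b rp (→L (here refl) Y⊆X e₁ e₂) (→L Y⊆X e₁ e₂)
cut-rightIntro m b rp (→L (there p) Y⊆X e₁ e₂)   =
  -, →L p Y⊆X (proj₂ (cut-rightIntro m b (rightIntro-weaken ⊆-refl there rp) e₁))
              (proj₂ (cut-rightIntro m b (rightIntro-weaken there ⊆-refl rp) (exchangeˡ e₂)))
cut-rightIntro {A = A} {Γ = Γ} {Δ = Δ} m b rp (∀R q z∉ e₁) =
  -, ∀R q (∉occ-mono Γ Δ (there {x = A}) ⊆-refl z∉)
          (proj₂ (cut-rightIntro m b (rightIntro-weaken ⊆-refl there rp) e₁))
cut-rightIntro m b rp (∀L (here refl) e₁)    = cut-principal m b rp (∀L (here refl) e₁) (∀L e₁)
cut-rightIntro m b rp (∀L (there p) e₁)      =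
  -, ∀L p (proj₂ (cut-rightIntro m b (rightIntro-weaken there ⊆-refl rp) (exchangeˡ e₁)))
cut-rightIntro m b rp (∃R q e₁)              =
  -, ∃R q (proj₂ (cut-rightIntro m b (rightIntro-weaken ⊆-refl there rp) e₁))
cut-rightIntro m b rp (∃L (here refl) z∉ e₁) = cut-principal m b rp (∃L (here refl) z∉ e₁) (∃L z∉ e₁)
cut-rightIntro {A = A} {Γ = Γ} {Δ = Δ} m b rp (∃L (there p) z∉ e₁) =
  -, ∃L p (∉occ-mono Γ Δ (there {x = A}) ⊆-refl z∉)
          (proj₂ (cut-rightIntro m b (rightIntro-weaken there ⊆-refl rp) (exchangeˡ e₁)))
cut-rightIntro m b rp (pad unary e)             = cut-rightIntro m b rp e
cut-rightIntro m b rp (pad binary₁ e)           = cut-rightIntro m b rp e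
cut-rightIntro m b rp (pad binary₂ e)           = cut-rightIntro m b rp e
cut-rightIntro m b rp (pad (perPoint _) e)      = cut-rightIntro m b rp e
cut-rightIntro m b rp (pad (perSublabel _ _) e) = cut-rightIntro m b rp e

cut-principal m b (ax p X⊆X₀) e (ax q Y⊆X) = -, ax p q (λ k∈ → X⊆X₀ (Y⊆X k∈))
cut-principal m b (atR prem)  e (ax q Y⊆X) =
  atR⊩ q (λ k k∈ → cut m b (exchangeʳ (prem k (Y⊆X k∈))) (weakenʳ e))
cut-principal (suc m) b@(s≤s b′) rp@(∧R {φ = φ} d₁ d₂) e (∧L e₁) =
  let _ , dφ  = cut (suc m) b (exchangeʳ d₁) (weakenʳ e)
      _ , dψ  = cut (suc m) b (exchangeʳ d₂) (weakenʳ e)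
      _ , eφψ = cut-rightIntro (suc m) b (rightIntro-weaken ⊆-drop² ⊆-refl rp) (weaken ⊆-rotate ⊆-refl e₁)
      _ , eψ  = cut m (m+n≤o⇒m≤o (size φ) b′) (weakenˡ dφ) eφψ
  in cut m (m+n≤o⇒n≤o (size φ) b′) dψ eψ
cut-principal (suc m) b@(s≤s b′) rp@(⩒R {φ = φ} d) e (⩒L e₁ e₂) =
  let _ , dφψ = cut (suc m) b (weaken ⊆-refl ⊆-rotate d) (weakenʳ (weakenʳ e))
      _ , eφ  = cut-rightIntro (suc m) b (rightIntro-weaken there ⊆-refl rp) (exchangeˡ e₁)
      _ , eψ  = cut-rightIntro (suc m) b (rightIntro-weaken there ⊆-refl rp) (exchangeˡ e₂)
      _ , dψ  = cut m (m+n≤o⇒m≤o (size φ) b′) dφψ (weakenʳ eφ)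
  in cut m (m+n≤o⇒n≤o (size φ) b′) dψ eψ
cut-principal (suc m) b@(s≤s b′) rp@(→R {φ = φ} prem) e (→L {Y = Y} Y⊆X e₁ e₂) =
  let _ , dφ  = cut-rightIntro (suc m) b (rightIntro-weaken ⊆-refl there rp) e₁
      _ , eψ  = cut-rightIntro (suc m) b (rightIntro-weaken there ⊆-refl rp) (exchangeˡ e₂)
      _ , dφψ = cut (suc m) b (exchangeʳ (prem Y Y⊆X)) (weakenʳ (exchangeˡ (weakenˡ e)))
      _ , dψ  = cut m (m+n≤o⇒m≤o (size φ) b′) (exchangeʳ (weakenʳ dφ)) dφψ
  in cut m (m+n≤o⇒n≤o (size φ) b′) dψ eψ
cut-principal (suc m) b@(s≤s b′) rp@(∀R {x = x} {φ = φ} z∉ d) e (∀L {y = y} e₁) =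
  let _ , dz = cut (suc m) b (exchangeʳ d) (weakenʳ e)
      _ , ey = cut-rightIntro (suc m) b (rightIntro-weaken there ⊆-refl rp) (exchangeˡ e₁)
  in cut m (subst (_≤ m) (sym (size-[/] φ y x)) b′) (eigenvariable-substʳ z∉ dz) ey
cut-principal (suc m) b@(s≤s b′) rp@(∃R {φ = φ} {y = y} {x = x} d) e (∃L z∉ e₁) =
  let _ , dy = cut (suc m) b (exchangeʳ d) (weakenʳ e)
      _ , ez = cut-rightIntro (suc m) b (rightIntro-weaken there ⊆-refl rp) (exchangeˡ e₁)
  in cut m (subst (_≤ m) (sym (size-[/] φ y x)) b′) dy (eigenvariable-substˡ z∉ ez)

cut-admissible : Γ ⊩ A ∷ Δ → A ∷ Γ ⊩ Δ → Γ ⊩ Δ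
cut-admissible {A = A} (_ , d) (_ , e) = cut (size (form A)) ≤-refl d e

-- Translation between the two calculi

weaken⊩ : Γ ⊆ Γ′ → Δ ⊆ Δ′ → Γ ⊩ Δ → Γ′ ⊩ Δ′
weaken⊩ Γ⊆ Δ⊆ (_ , d) = -, weaken Γ⊆ Δ⊆ d

⊢⇒⊩ : Γ ⊢ Δ → Γ ⊩ Δ
⊢⇒⊩ (perm Γ↭ Δ↭ d) = weaken⊩ (∈-resp-↭ Γ↭) (∈-resp-↭ Δ↭) (⊢⇒⊩ d)
⊢⇒⊩ (idax Y⊆X)     = -, ax (here refl) (here refl) Y⊆X
⊢⇒⊩ ⊥⇒            = -, ⊥L (here refl)
⊢⇒⊩ (⇒at prem)     = atR⊩ (here refl) (λ k k∈ → weaken⊩ ⊆-refl (∷⁺ʳ _ there) (⊢⇒⊩ (prem k k∈)))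
⊢⇒⊩ (⇒∧ d₁ d₂)     = -, ∧R (here refl) (weaken ⊆-refl (∷⁺ʳ _ there) (proj₂ (⊢⇒⊩ d₁)))
                                        (weaken ⊆-refl (∷⁺ʳ _ there) (proj₂ (⊢⇒⊩ d₂)))
⊢⇒⊩ (∧⇒ d)         = -, ∧L (here refl) (weaken (∷⁺ʳ _ (∷⁺ʳ _ there)) ⊆-refl (proj₂ (⊢⇒⊩ d)))
⊢⇒⊩ (⇒⩒ d)         = -, ⩒R (here refl) (weaken ⊆-refl (∷⁺ʳ _ (∷⁺ʳ _ there)) (proj₂ (⊢⇒⊩ d)))
⊢⇒⊩ (⩒⇒ d₁ d₂)     = -, ⩒L (here refl) (weaken (∷⁺ʳ _ there) ⊆-refl (proj₂ (⊢⇒⊩ d₁)))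
                                        (weaken (∷⁺ʳ _ there) ⊆-refl (proj₂ (⊢⇒⊩ d₂)))
⊢⇒⊩ (⇒→ prem)      = →R⊩ (here refl) (λ Y Y⊆ → weaken⊩ ⊆-refl (∷⁺ʳ _ there) (⊢⇒⊩ (prem Y Y⊆)))
⊢⇒⊩ (→⇒ Y⊆X d₁ d₂) = -, →L (here refl) Y⊆X (proj₂ (⊢⇒⊩ d₁)) (proj₂ (⊢⇒⊩ d₂))
⊢⇒⊩ (⇒∀ z∉ d)      = -, ∀R (here refl) z∉ (weaken ⊆-refl (∷⁺ʳ _ there) (proj₂ (⊢⇒⊩ d)))
⊢⇒⊩ (∀⇒ d)         = -, ∀L (here refl) (proj₂ (⊢⇒⊩ d))
⊢⇒⊩ (⇒∃ d)         = -, ∃R (here refl) (exchangeʳ (proj₂ (⊢⇒⊩ d)))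
⊢⇒⊩ (∃⇒ z∉ d)      = -, ∃L (here refl) z∉ (weaken (∷⁺ʳ _ there) ⊆-refl (proj₂ (⊢⇒⊩ d)))

∈⇒↭ : A ∈ Γ → ∃ λ Γ₀ → Γ ↭ A ∷ Γ₀
∈⇒↭ {A = A} A∈ with ∈-∃++ A∈
... | Γ₁ , Γ₂ , refl = Γ₁ ++ Γ₂ , shift A Γ₁ Γ₂

invertˡ : ∀ {Γ₀} → Γ ↭ A ∷ Γ₀ → LeftCover Γ′ (elems (lab A)) (rename id (nameless (form A))) →
  Γ₀ ⊆ Γ′ → Δ ⊆ Δ′ → Covers id Γ Δ Γ′ Δ′
invertˡ π c Γ₀⊆ Δ⊆ = covers-antimono (∈-resp-↭ π) ⊆-refl (c ◁ˡ covers-id Γ₀⊆ Δ⊆)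

invertʳ : ∀ {Δ₀} → Δ ↭ A ∷ Δ₀ → RightCover Γ′ Δ′ (elems (lab A)) (rename id (nameless (form A))) →
  Γ ⊆ Γ′ → Δ₀ ⊆ Δ′ → Covers id Γ Δ Γ′ Δ′
invertʳ π c Γ⊆ Δ₀⊆ = covers-antimono ⊆-refl (∈-resp-↭ π) (c ◁ʳ covers-id Γ⊆ Δ₀⊆)

headˡ : LeftCover (A ∷ Γ) (elems (lab A)) (rename id (nameless (form A)))
headˡ = idCoverˡ (here refl)

headʳ : RightCover Γ (A ∷ Δ) (elems (lab A)) (rename id (nameless (form A)))
headʳ = idCoverʳ (here refl)

-- A premise keeps the principal formula, which _⊢_ drops; simulation removes
-- it, since it is covered by what the rule added.
⊢[]⇒⊢ : Γ ⊢[ s ] Δ → Γ ⊢ Δ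
⊢[]⇒⊢ (ax p q Y⊆X) with ∈⇒↭ p | ∈⇒↭ q
... | _ , πΓ | _ , πΔ = perm (↭-sym πΓ) (↭-sym πΔ) (idax Y⊆X)
⊢[]⇒⊢ (⊥L p) with ∈⇒↭ p
... | _ , π = perm (↭-sym π) ↭-refl ⊥⇒
⊢[]⇒⊢ (atR p prem) with ∈⇒↭ p
... | _ , π = perm ↭-refl (↭-sym π) (⇒at λ k k∈ →
  ⊢[]⇒⊢ (simulate (prem k k∈) id (headʳ ◁ʳ invertʳ π (at k∈ headʳ) ⊆-refl there)))
⊢[]⇒⊢ (∧R p d₁ d₂) with ∈⇒↭ p
... | _ , π = perm ↭-refl (↭-sym π) (⇒∧
  (⊢[]⇒⊢ (simulate d₁ id (headʳ ◁ʳ invertʳ π (and₁ headʳ) ⊆-refl there)))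
  (⊢[]⇒⊢ (simulate d₂ id (headʳ ◁ʳ invertʳ π (and₂ headʳ) ⊆-refl there))))
⊢[]⇒⊢ (∧L p d) with ∈⇒↭ p
... | _ , π = perm (↭-sym π) ↭-refl (∧⇒
  (⊢[]⇒⊢ (simulate d id (headˡ ◁ˡ second ◁ˡ invertˡ π (and headˡ second) ⊆-drop² ⊆-refl))))
  where second = idCoverˡ (there (here refl))
⊢[]⇒⊢ (⩒R p d) with ∈⇒↭ p
... | _ , π = perm ↭-refl (↭-sym π) (⇒⩒
  (⊢[]⇒⊢ (simulate d id (headʳ ◁ʳ second ◁ʳ invertʳ π (or headʳ second) ⊆-refl ⊆-drop²))))
  where second = idCoverʳ (there (here refl))
⊢[]⇒⊢ (⩒L p d₁ d₂) with ∈⇒↭ p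
... | _ , π = perm (↭-sym π) ↭-refl (⩒⇒
  (⊢[]⇒⊢ (simulate d₁ id (headˡ ◁ˡ invertˡ π (or₁ headˡ) there ⊆-refl)))
  (⊢[]⇒⊢ (simulate d₂ id (headˡ ◁ˡ invertˡ π (or₂ headˡ) there ⊆-refl))))
⊢[]⇒⊢ (→R p prem) with ∈⇒↭ p
... | _ , π = perm ↭-refl (↭-sym π) (⇒→ λ Y Y⊆ →
  ⊢[]⇒⊢ (simulate (prem Y Y⊆) id (headˡ ◁ˡ headʳ ◁ʳ invertʳ π (imp Y Y⊆ headˡ headʳ) there there)))
⊢[]⇒⊢ (→L p Y⊆X d₁ d₂) with ∈⇒↭ p
... | _ , π = perm (↭-sym π) ↭-refl
  (→⇒ Y⊆X (⊢[]⇒⊢ (weaken (∈-resp-↭ π) ⊆-refl d₁)) (⊢[]⇒⊢ (weaken (∷⁺ʳ _ (∈-resp-↭ π)) ⊆-refl d₂)))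
⊢[]⇒⊢ {Γ = Γ} (∀R {x = x} {φ = φ} {z = z} p z∉ d) with ∈⇒↭ p
... | Δ₀ , π = perm ↭-refl (↭-sym π) (⇒∀ (∉occ-mono Γ (_ ∷ Δ₀) ⊆-refl (∈-resp-↭ (↭-sym π)) z∉)
  (⊢[]⇒⊢ (simulate d id (headʳ ◁ʳ invertʳ π (all z at-z) ⊆-refl there))))
  where at-z = has (here refl) refl (nameless-instance z x φ)
⊢[]⇒⊢ (∀L p d) with ∈⇒↭ p
... | _ , π = perm (↭-sym π) ↭-refl (∀⇒ (⊢[]⇒⊢ (weaken (∷⁺ʳ _ (∈-resp-↭ π)) ⊆-refl d)))
⊢[]⇒⊢ (∃R p d) with ∈⇒↭ p
... | _ , π = perm ↭-refl (↭-sym π) (⇒∃ (⊢[]⇒⊢ (exchangeʳ (weaken ⊆-refl (∷⁺ʳ _ (∈-resp-↭ π)) d))))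
⊢[]⇒⊢ {Δ = Δ} (∃L {x = x} {φ = φ} {z = z} p z∉ d) with ∈⇒↭ p
... | Γ₀ , π = perm (↭-sym π) ↭-refl (∃⇒ (∉occ-mono (_ ∷ Γ₀) Δ (∈-resp-↭ (↭-sym π)) ⊆-refl z∉)
  (⊢[]⇒⊢ (simulate d id (headˡ ◁ˡ invertˡ π (ex z at-z) there ⊆-refl))))
  where at-z = has (here refl) refl (nameless-instance z x φ)
⊢[]⇒⊢ (pad unary d)             = ⊢[]⇒⊢ d
⊢[]⇒⊢ (pad binary₁ d)           = ⊢[]⇒⊢ d
⊢[]⇒⊢ (pad binary₂ d)           = ⊢[]⇒⊢ d
⊢[]⇒⊢ (pad (perPoint _) d)      = ⊢[]⇒⊢ d
⊢[]⇒⊢ (pad (perSublabel _ _) d) = ⊢[]⇒⊢ d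

theorem6 : (Γ Δ Π Σ : List LFormula) (X : Label) (φ : Formula) →
    Γ ⊢ (X ∶ φ) ∷ Δ → (X ∶ φ) ∷ Π ⊢ Σ → Γ ++ Π ⊢ Δ ++ Σ
theorem6 Γ Δ Π Σ X φ d e =
  ⊢[]⇒⊢ (proj₂ (cut-admissible
    (weaken⊩ (xs⊆xs++ys Γ Π) (∷⁺ʳ _ (xs⊆xs++ys Δ Σ)) (⊢⇒⊩ d))
    (weaken⊩ (∷⁺ʳ _ (xs⊆ys++xs Π Γ)) (xs⊆ys++xs Σ Δ) (⊢⇒⊩ e))))
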